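{- Let $OABC$ be an integer multistory completely empty marked pyramid in $\mathbb R^3$ with vertex $O$ and triangular base $ABC$, where $ABC$ is integer-affine equivalent to the triangle with vertices $(-2,1),(-1,-1),(1,2)$. Then $OABC$ is two-story and integer-affine equivalent to the marked pyramid $V$ with vertex $(0,0,0)$ and base $(2,-2,1),(2,-1,-1),(2,1,2)$.
   Context: Integer-affine equivalence of marked pyramids: affine automorphism of $\mathbb R^3$ preserving $\mathbb Z^3$ sending vertex to vertex; a base triangle in an integer plane is compared with a triangle of $\mathbb R^2$ via an affine isomorphism matching integer points. Completely empty: no integer points other than the vertex and the integer points of the base. $l$-story: integer distance from vertex to the base plane equals $l$ (Euclidean distance divided by the minimal nonzero Euclidean distance to the plane of integer points in the affine span of the plane and the vertex); multistory: $l>1$. -}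

module Defs where

open import Data.Nat using (ℕ)
open import Data.Integer as ℤ using (ℤ; +_; -[1+_]; ∣_∣)
open import Data.Rational as ℚ using (ℚ; 0ℚ; 1ℚ)
open import Data.Product using (Σ; ∃; ∃-syntax; _×_; _,_)
open import Data.Sum using (_⊎_)
open import Data.List using (List; []; _∷_)
open import Data.List.Relation.Binary.Permutation.Propositional using (_↭_)
open import Relation.Binary.PropositionalEquality using (_≡_; _≢_)

Pt2 : Set
Pt2 = ℤ × ℤ

Pt3 : Set
Pt3 = ℤ × ℤ × ℤ

-- rational points of ℝ³ (all points relevant here have rational coordinates)
Q3 : Set
Q3 = ℚ × ℚ × ℚ

ι : ℤ → ℚ
ι z = z ℚ./ 1

ι3 : Pt3 → Q3
ι3 (x , y , z) = ι x , ι y , ι z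

_-₃_ : Pt3 → Pt3 → Pt3
(a₁ , a₂ , a₃) -₃ (b₁ , b₂ , b₃) = (a₁ ℤ.- b₁) , (a₂ ℤ.- b₂) , (a₃ ℤ.- b₃)

_+₃_ : Pt3 → Pt3 → Pt3
(a₁ , a₂ , a₃) +₃ (b₁ , b₂ , b₃) = (a₁ ℤ.+ b₁) , (a₂ ℤ.+ b₂) , (a₃ ℤ.+ b₃)

_·₃_ : ℤ → Pt3 → Pt3
k ·₃ (b₁ , b₂ , b₃) = (k ℤ.* b₁) , (k ℤ.* b₂) , (k ℤ.* b₃)

_+q_ : Q3 → Q3 → Q3
(a₁ , a₂ , a₃) +q (b₁ , b₂ , b₃) = (a₁ ℚ.+ b₁) , (a₂ ℚ.+ b₂) , (a₃ ℚ.+ b₃)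

_·q_ : ℚ → Q3 → Q3
k ·q (b₁ , b₂ , b₃) = (k ℚ.* b₁) , (k ℚ.* b₂) , (k ℚ.* b₃)

dot : Pt3 → Pt3 → ℤ
dot (a₁ , a₂ , a₃) (b₁ , b₂ , b₃) = a₁ ℤ.* b₁ ℤ.+ a₂ ℤ.* b₂ ℤ.+ a₃ ℤ.* b₃

cross : Pt3 → Pt3 → Pt3
cross (a₁ , a₂ , a₃) (b₁ , b₂ , b₃) =
  (a₂ ℤ.* b₃ ℤ.- a₃ ℤ.* b₂) , (a₃ ℤ.* b₁ ℤ.- a₁ ℤ.* b₃) , (a₁ ℤ.* b₂ ℤ.- a₂ ℤ.* b₁)

det3 : Pt3 → Pt3 → Pt3 → ℤ
det3 u v w = dot u (cross v w)

NonDegenerate : Pt3 → Pt3 → Pt3 → Pt3 → Set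
NonDegenerate O A B C = det3 (A -₃ O) (B -₃ O) (C -₃ O) ≢ + 0

InPyramid : Pt3 → Pt3 → Pt3 → Pt3 → Pt3 → Set
InPyramid O A B C P =
  ∃[ a ] ∃[ b ] ∃[ c ]
    (0ℚ ℚ.≤ a × 0ℚ ℚ.≤ b × 0ℚ ℚ.≤ c × a ℚ.+ b ℚ.+ c ℚ.≤ 1ℚ ×
     ι3 P ≡ ι3 O +q ((a ·q ι3 (A -₃ O)) +q ((b ·q ι3 (B -₃ O)) +q (c ·q ι3 (C -₃ O)))))

InTriangle : Pt3 → Pt3 → Pt3 → Pt3 → Set
InTriangle A B C P =
  ∃[ a ] ∃[ b ] ∃[ c ]
    (0ℚ ℚ.≤ a × 0ℚ ℚ.≤ b × 0ℚ ℚ.≤ c × a ℚ.+ b ℚ.+ c ≡ 1ℚ ×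
     ι3 P ≡ (a ·q ι3 A) +q ((b ·q ι3 B) +q (c ·q ι3 C)))

InPlane : Pt3 → Pt3 → Pt3 → Q3 → Set
InPlane A B C P =
  ∃[ s ] ∃[ t ] (P ≡ ι3 A +q ((s ·q ι3 (B -₃ A)) +q (t ·q ι3 (C -₃ A))))

CompletelyEmpty : Pt3 → Pt3 → Pt3 → Pt3 → Set
CompletelyEmpty O A B C =
  ∀ (P : Pt3) → InPyramid O A B C P → P ≡ O ⊎ InTriangle A B C P

-- With the (integer) normal n = (B-A)×(C-A), the Euclidean distance of a point
-- P to the base plane is |n·(P-A)|/|n|; so the ratio of the Euclidean distance of O
-- to the minimal nonzero Euclidean distance of an integer point is
-- |n·(O-A)| / m, where m is the minimal nonzero |n·(P-A)|, P ∈ ℤ³.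
IntDist : Pt3 → Pt3 → Pt3 → Pt3 → ℕ → Set
IntDist O A B C l =
  ∃[ m ]
    ( (∃[ P ] ∣ dot n (P -₃ A) ∣ ≡ Data.Nat.suc m)
    × (∀ (P : Pt3) → dot n (P -₃ A) ≢ + 0 → Data.Nat.suc m Data.Nat.≤ ∣ dot n (P -₃ A) ∣)
    × ∣ dot n (O -₃ A) ∣ ≡ l Data.Nat.* Data.Nat.suc m )
  where
    n : Pt3
    n = cross (B -₃ A) (C -₃ A)

affMap2 : Pt3 → Pt3 → Pt3 → Pt2 → Pt3
affMap2 P u v (x , y) = P +₃ ((x ·₃ u) +₃ (y ·₃ v))

-- The base triangle ABC (in an integer plane) is integer-affine equivalent to the
-- plane triangle with vertices T₁ T₂ T₃: there is an affine isomorphism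
-- ψ : ℝ² → aff(ABC) carrying ℤ² bijectively onto aff(ABC) ∩ ℤ³ (such a ψ is
-- necessarily of the form (x,y) ↦ P + x u + y v with P u v integer) and carrying
-- the vertex set {T₁,T₂,T₃} onto {A,B,C}.
TriangleEquiv : Pt3 → Pt3 → Pt3 → Pt2 → Pt2 → Pt2 → Set
TriangleEquiv A B C T₁ T₂ T₃ =
  ∃[ P ] ∃[ u ] ∃[ v ]
    ( (∀ (p q : Pt2) → affMap2 P u v p ≡ affMap2 P u v q → p ≡ q)
    × (∀ (p : Pt2) → InPlane A B C (ι3 (affMap2 P u v p)))
    × (∀ (Q : Pt3) → InPlane A B C (ι3 Q) → ∃[ p ] affMap2 P u v p ≡ Q)
    × (affMap2 P u v T₁ ∷ affMap2 P u v T₂ ∷ affMap2 P u v T₃ ∷ []) ↭ (A ∷ B ∷ C ∷ []) )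

Mat3 : Set
Mat3 = Pt3 × Pt3 × Pt3

apply : Mat3 → Pt3 → Pt3
apply (r₁ , r₂ , r₃) x = dot r₁ x , dot r₂ x , dot r₃ x

PyramidEquiv : Pt3 → Pt3 → Pt3 → Pt3 → Pt3 → Pt3 → Pt3 → Pt3 → Set
PyramidEquiv O A B C O' A' B' C' =
  ∃[ M ] ∃[ N ] ∃[ t ]
    ( (∀ x → apply N (apply M x) ≡ x)
    × (∀ x → apply M (apply N x) ≡ x)
    × F M t O ≡ O'
    × (F M t A ∷ F M t B ∷ F M t C ∷ []) ↭ (A' ∷ B' ∷ C' ∷ []) )
  where
    F : Mat3 → Pt3 → Pt3 → Pt3
    F M t x = apply M x +₃ t

module Submission where

open import Defs
open import Data.Nat using (ℕ; _<_)
open import Data.Integer using (ℤ; +_; -[1+_])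
open import Data.Product using (∃-syntax; _×_; _,_)

open import Data.Empty using (⊥; ⊥-elim)
open import Data.Integer as ℤ using (0ℤ; _+_; _*_; _-_; -_; ∣_∣; +[1+_])
open import Data.Integer.DivMod using (_%ℕ_; _/ℕ_; a≡a%ℕn+[a/ℕn]*n; n%ℕd<d)
import Data.Integer.Properties as ℤP
open import Data.Integer.Tactic.RingSolver using (solve-∀; solve)
open import Data.List using (List; []; _∷_; map)
open import Data.List.Properties using (∷-injectiveˡ)
open import Data.List.Relation.Binary.Permutation.Propositional using (_↭_; prep; swap; ↭-sym; ↭-trans; ↭-refl)
open import Data.List.Relation.Binary.Permutation.Propositional.Properties
  using (∈-resp-↭; drop-∷; ↭-singleton-inv; map⁺)
open import Data.List.Relation.Unary.Any using (here; there)
open import Data.Maybe using (nothing)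
import Data.Nat as ℕ
open import Data.Nat using (suc)
import Data.Nat.DivMod as ℕ
import Data.Nat.Properties as ℕP
open import Data.Product using (proj₁; proj₂)
open import Data.Rational as ℚ using (ℚ; 0ℚ; 1ℚ)
import Data.Rational.Properties as ℚP
open import Data.Rational.Unnormalised as ℚᵘ using (mkℚᵘ; *≡*; *≤*) renaming (_≃_ to _≃ᵘ_)
import Data.Rational.Unnormalised.Properties as ℚᵘP
open import Data.Sum using (_⊎_; inj₁; inj₂; [_,_]′; map₂)
open import Function using (_∘_; _∋_)
open import Relation.Binary.PropositionalEquality
open import Relation.Nullary using (¬_; yes; no)
import Tactic.RingSolver as RingSolver
import Tactic.RingSolver.Core.AlmostCommutativeRing as ACR

-- Write the base as the image of ℤ² under ψ p = P + p₁ u + p₂ v, which by hypothesis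
-- is onto the lattice points of the base plane.  A lattice point closest to that plane yields a
-- vector w with (u × v) · w = 1, so (u , v , w) is a basis of ℤ³ and the apex is
-- O = P + α u + β v ± l w, where l is its integer distance to the base.  Complete emptiness
-- forbids lattice points at height one in the pyramid, that is, lattice points in the slice
-- ((l - 1) T + (α , β)) / l.  For the triangle T this forces l = 2 with α and β even, and then an
-- explicit unimodular map written in the frame (u , v , w) carries the pyramid onto V.

-- Integer vectors and frames

≡₃ : ∀ {A : Set} {x₁ x₂ x₃ y₁ y₂ y₃ : A} → x₁ ≡ y₁ → x₂ ≡ y₂ → x₃ ≡ y₃ → (x₁ , x₂ , x₃) ≡ (y₁ , y₂ , y₃)
≡₃ refl refl refl = refl

linear-combination₁ : ∀ {x y a b : ℤ} (c : ℤ) → a ≡ b → x ≡ y + c * (a - b) → x ≡ y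
linear-combination₁ {y = y} {b = b} c refl e = trans e (solve (y ∷ c ∷ b ∷ []))

linear-combination₂ : ∀ {x y a₁ b₁ a₂ b₂ : ℤ} (c₁ c₂ : ℤ) → a₁ ≡ b₁ → a₂ ≡ b₂ →
  x ≡ y + (c₁ * (a₁ - b₁) + c₂ * (a₂ - b₂)) → x ≡ y
linear-combination₂ {y = y} {b₁ = b₁} {b₂ = b₂} c₁ c₂ refl refl e = trans e (solve (y ∷ c₁ ∷ c₂ ∷ b₁ ∷ b₂ ∷ []))

linear-combination₃ : ∀ {x y a₁ b₁ a₂ b₂ a₃ b₃ : ℤ} (c₁ c₂ c₃ : ℤ) → a₁ ≡ b₁ → a₂ ≡ b₂ → a₃ ≡ b₃ →
  x ≡ y + (c₁ * (a₁ - b₁) + c₂ * (a₂ - b₂) + c₃ * (a₃ - b₃)) → x ≡ y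
linear-combination₃ {y = y} {b₁ = b₁} {b₂ = b₂} {b₃ = b₃} c₁ c₂ c₃ refl refl refl e =
  trans e (solve (y ∷ c₁ ∷ c₂ ∷ c₃ ∷ b₁ ∷ b₂ ∷ b₃ ∷ []))

+-cancelˡ : ∀ z {x y} → z + x ≡ z + y → x ≡ y
+-cancelˡ z {x} {y} e = linear-combination₁ (+ 1) e (solve (z ∷ x ∷ y ∷ []))

transpose : Mat3 → Mat3
transpose ((a , b , c) , (d , e , f) , (g , h , i)) = (a , d , g) , (b , e , h) , (c , f , i)

_⊙_ : Mat3 → Mat3 → Mat3
(r₁ , r₂ , r₃) ⊙ M = apply (transpose M) r₁ , apply (transpose M) r₂ , apply (transpose M) r₃

frame : Pt3 → Pt3 → Pt3 → Mat3
frame u v w = transpose (u , v , w)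

coframe : Pt3 → Pt3 → Pt3 → Mat3
coframe u v w = cross v w , cross w u , cross u v

det₂ : Pt2 → Pt2 → Pt2 → ℤ
det₂ (a₁ , a₂) (b₁ , b₂) (c₁ , c₂) = (b₁ - a₁) * (c₂ - a₂) - (b₂ - a₂) * (c₁ - a₁)

dot-transpose : ∀ (r₁ r₂ r₃ m₁ m₂ m₃ m₄ m₅ m₆ m₇ m₈ m₉ x₁ x₂ x₃ : ℤ) →
  (m₁ * r₁ + m₄ * r₂ + m₇ * r₃) * x₁ + (m₂ * r₁ + m₅ * r₂ + m₈ * r₃) * x₂ + (m₃ * r₁ + m₆ * r₂ + m₉ * r₃) * x₃ ≡
  r₁ * (m₁ * x₁ + m₂ * x₂ + m₃ * x₃) + r₂ * (m₄ * x₁ + m₅ * x₂ + m₆ * x₃) + r₃ * (m₇ * x₁ + m₈ * x₂ + m₉ * x₃)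
dot-transpose = solve-∀

apply-⊙ : ∀ M M′ x → apply (M ⊙ M′) x ≡ apply M (apply M′ x)
apply-⊙ ((a₁ , a₂ , a₃) , (b₁ , b₂ , b₃) , (c₁ , c₂ , c₃)) ((m₁ , m₂ , m₃) , (m₄ , m₅ , m₆) , (m₇ , m₈ , m₉)) (x₁ , x₂ , x₃) =
  ≡₃ (dot-transpose a₁ a₂ a₃ m₁ m₂ m₃ m₄ m₅ m₆ m₇ m₈ m₉ x₁ x₂ x₃)
     (dot-transpose b₁ b₂ b₃ m₁ m₂ m₃ m₄ m₅ m₆ m₇ m₈ m₉ x₁ x₂ x₃)
     (dot-transpose c₁ c₂ c₃ m₁ m₂ m₃ m₄ m₅ m₆ m₇ m₈ m₉ x₁ x₂ x₃)

-- The ring solver only sees syntactic polynomials, so the coordinates of both sides are written out.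
frame-coframe : ∀ u v w x → apply (frame u v w) (apply (coframe u v w) x) ≡ det3 u v w ·₃ x
frame-coframe (u₁ , u₂ , u₃) (v₁ , v₂ , v₃) (w₁ , w₂ , w₃) (x₁ , x₂ , x₃) =
  let ζ₁ = (v₂ * w₃ - v₃ * w₂) * x₁ + (v₃ * w₁ - v₁ * w₃) * x₂ + (v₁ * w₂ - v₂ * w₁) * x₃
      ζ₂ = (w₂ * u₃ - w₃ * u₂) * x₁ + (w₃ * u₁ - w₁ * u₃) * x₂ + (w₁ * u₂ - w₂ * u₁) * x₃
      ζ₃ = (u₂ * v₃ - u₃ * v₂) * x₁ + (u₃ * v₁ - u₁ * v₃) * x₂ + (u₁ * v₂ - u₂ * v₁) * x₃
      g  = u₁ * (v₂ * w₃ - v₃ * w₂) + u₂ * (v₃ * w₁ - v₁ * w₃) + u₃ * (v₁ * w₂ - v₂ * w₁)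
      vs = u₁ ∷ u₂ ∷ u₃ ∷ v₁ ∷ v₂ ∷ v₃ ∷ w₁ ∷ w₂ ∷ w₃ ∷ x₁ ∷ x₂ ∷ x₃ ∷ []
  in ≡₃ {x₁ = u₁ * ζ₁ + v₁ * ζ₂ + w₁ * ζ₃} {u₂ * ζ₁ + v₂ * ζ₂ + w₂ * ζ₃} {u₃ * ζ₁ + v₃ * ζ₂ + w₃ * ζ₃}
        {g * x₁} {g * x₂} {g * x₃} (solve vs) (solve vs) (solve vs)

coframe-frame : ∀ u v w x → apply (coframe u v w) (apply (frame u v w) x) ≡ det3 u v w ·₃ x
coframe-frame (u₁ , u₂ , u₃) (v₁ , v₂ , v₃) (w₁ , w₂ , w₃) (x₁ , x₂ , x₃) =
  let y₁ = u₁ * x₁ + v₁ * x₂ + w₁ * x₃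
      y₂ = u₂ * x₁ + v₂ * x₂ + w₂ * x₃
      y₃ = u₃ * x₁ + v₃ * x₂ + w₃ * x₃
      g  = u₁ * (v₂ * w₃ - v₃ * w₂) + u₂ * (v₃ * w₁ - v₁ * w₃) + u₃ * (v₁ * w₂ - v₂ * w₁)
      vs = u₁ ∷ u₂ ∷ u₃ ∷ v₁ ∷ v₂ ∷ v₃ ∷ w₁ ∷ w₂ ∷ w₃ ∷ x₁ ∷ x₂ ∷ x₃ ∷ []
  in ≡₃ {x₁ = (v₂ * w₃ - v₃ * w₂) * y₁ + (v₃ * w₁ - v₁ * w₃) * y₂ + (v₁ * w₂ - v₂ * w₁) * y₃}
        {(w₂ * u₃ - w₃ * u₂) * y₁ + (w₃ * u₁ - w₁ * u₃) * y₂ + (w₁ * u₂ - w₂ * u₁) * y₃}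
        {(u₂ * v₃ - u₃ * v₂) * y₁ + (u₃ * v₁ - u₁ * v₃) * y₂ + (u₁ * v₂ - u₂ * v₁) * y₃}
        {g * x₁} {g * x₂} {g * x₃} (solve vs) (solve vs) (solve vs)

det3-frame : ∀ u v w x y z →
  det3 (apply (frame u v w) x) (apply (frame u v w) y) (apply (frame u v w) z) ≡ det3 u v w * det3 x y z
det3-frame (u₁ , u₂ , u₃) (v₁ , v₂ , v₃) (w₁ , w₂ , w₃) (x₁ , x₂ , x₃) (y₁ , y₂ , y₃) (z₁ , z₂ , z₃) =
  let a₁ = u₁ * x₁ + v₁ * x₂ + w₁ * x₃ ; a₂ = u₂ * x₁ + v₂ * x₂ + w₂ * x₃ ; a₃ = u₃ * x₁ + v₃ * x₂ + w₃ * x₃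
      b₁ = u₁ * y₁ + v₁ * y₂ + w₁ * y₃ ; b₂ = u₂ * y₁ + v₂ * y₂ + w₂ * y₃ ; b₃ = u₃ * y₁ + v₃ * y₂ + w₃ * y₃
      c₁ = u₁ * z₁ + v₁ * z₂ + w₁ * z₃ ; c₂ = u₂ * z₁ + v₂ * z₂ + w₂ * z₃ ; c₃ = u₃ * z₁ + v₃ * z₂ + w₃ * z₃
  in (a₁ * (b₂ * c₃ - b₃ * c₂) + a₂ * (b₃ * c₁ - b₁ * c₃) + a₃ * (b₁ * c₂ - b₂ * c₁) ≡
      (u₁ * (v₂ * w₃ - v₃ * w₂) + u₂ * (v₃ * w₁ - v₁ * w₃) + u₃ * (v₁ * w₂ - v₂ * w₁)) *
      (x₁ * (y₂ * z₃ - y₃ * z₂) + x₂ * (y₃ * z₁ - y₁ * z₃) + x₃ * (y₁ * z₂ - y₂ * z₁)))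
     ∋ solve (u₁ ∷ u₂ ∷ u₃ ∷ v₁ ∷ v₂ ∷ v₃ ∷ w₁ ∷ w₂ ∷ w₃ ∷ x₁ ∷ x₂ ∷ x₃ ∷ y₁ ∷ y₂ ∷ y₃ ∷ z₁ ∷ z₂ ∷ z₃ ∷ [])

det3-cross : ∀ u v w → det3 u v w ≡ dot (cross u v) w
det3-cross (u₁ , u₂ , u₃) (v₁ , v₂ , v₃) (w₁ , w₂ , w₃) =
  (u₁ * (v₂ * w₃ - v₃ * w₂) + u₂ * (v₃ * w₁ - v₁ * w₃) + u₃ * (v₁ * w₂ - v₂ * w₁) ≡
   (u₂ * v₃ - u₃ * v₂) * w₁ + (u₃ * v₁ - u₁ * v₃) * w₂ + (u₁ * v₂ - u₂ * v₁) * w₃)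
  ∋ solve (u₁ ∷ u₂ ∷ u₃ ∷ v₁ ∷ v₂ ∷ v₃ ∷ w₁ ∷ w₂ ∷ w₃ ∷ [])

·₃-identityˡ : ∀ x → (+ 1) ·₃ x ≡ x
·₃-identityˡ (x₁ , x₂ , x₃) = ≡₃ (ℤP.*-identityˡ x₁) (ℤP.*-identityˡ x₂) (ℤP.*-identityˡ x₃)

dot-·₃ʳ : ∀ n k x → dot n (k ·₃ x) ≡ k * dot n x
dot-·₃ʳ (n₁ , n₂ , n₃) k (x₁ , x₂ , x₃) =
  (n₁ * (k * x₁) + n₂ * (k * x₂) + n₃ * (k * x₃) ≡ k * (n₁ * x₁ + n₂ * x₂ + n₃ * x₃))
  ∋ solve (n₁ ∷ n₂ ∷ n₃ ∷ k ∷ x₁ ∷ x₂ ∷ x₃ ∷ [])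

dot-shifted : ∀ n P y q w → dot n ((P +₃ (y -₃ (q ·₃ w))) -₃ P) ≡ dot n y - q * dot n w
dot-shifted (n₁ , n₂ , n₃) (p₁ , p₂ , p₃) (y₁ , y₂ , y₃) q (w₁ , w₂ , w₃) =
  (n₁ * (p₁ + (y₁ - q * w₁) - p₁) + n₂ * (p₂ + (y₂ - q * w₂) - p₂) + n₃ * (p₃ + (y₃ - q * w₃) - p₃) ≡
   n₁ * y₁ + n₂ * y₂ + n₃ * y₃ - q * (n₁ * w₁ + n₂ * w₂ + n₃ * w₃))
  ∋ solve (n₁ ∷ n₂ ∷ n₃ ∷ p₁ ∷ p₂ ∷ p₃ ∷ y₁ ∷ y₂ ∷ y₃ ∷ q ∷ w₁ ∷ w₂ ∷ w₃ ∷ [])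

translate-row : ∀ m₁ m₂ m₃ p₁ p₂ p₃ y₁ y₂ y₃ e →
  m₁ * (p₁ + y₁) + m₂ * (p₂ + y₂) + m₃ * (p₃ + y₃) + (e - (m₁ * p₁ + m₂ * p₂ + m₃ * p₃)) ≡
  m₁ * y₁ + m₂ * y₂ + m₃ * y₃ + e
translate-row = solve-∀

apply-translate : ∀ M P y e → apply M (P +₃ y) +₃ (e -₃ apply M P) ≡ apply M y +₃ e
apply-translate ((a₁ , a₂ , a₃) , (b₁ , b₂ , b₃) , (c₁ , c₂ , c₃)) (p₁ , p₂ , p₃) (y₁ , y₂ , y₃) (e₁ , e₂ , e₃) =
  ≡₃ (translate-row a₁ a₂ a₃ p₁ p₂ p₃ y₁ y₂ y₃ e₁) (translate-row b₁ b₂ b₃ p₁ p₂ p₃ y₁ y₂ y₃ e₂)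
     (translate-row c₁ c₂ c₃ p₁ p₂ p₃ y₁ y₂ y₃ e₃)

affMap2-frame : ∀ P u v w p₁ p₂ → affMap2 P u v (p₁ , p₂) ≡ P +₃ apply (frame u v w) (p₁ , p₂ , 0ℤ)
affMap2-frame (p₁ , p₂ , p₃) (u₁ , u₂ , u₃) (v₁ , v₂ , v₃) (w₁ , w₂ , w₃) x y =
  ≡₃ (row p₁ u₁ v₁ w₁) (row p₂ u₂ v₂ w₂) (row p₃ u₃ v₃ w₃)
  where
  row : ∀ p u v w → p + (x * u + y * v) ≡ p + (u * x + v * y + w * 0ℤ)
  row p u v w = solve (p ∷ u ∷ v ∷ w ∷ x ∷ y ∷ [])

dot-affMap2 : ∀ P u v p → dot (cross u v) (affMap2 P u v p) ≡ dot (cross u v) P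
dot-affMap2 (p₁ , p₂ , p₃) (u₁ , u₂ , u₃) (v₁ , v₂ , v₃) (x , y) =
  let n₁ = u₂ * v₃ - u₃ * v₂ ; n₂ = u₃ * v₁ - u₁ * v₃ ; n₃ = u₁ * v₂ - u₂ * v₁ in
  (n₁ * (p₁ + (x * u₁ + y * v₁)) + n₂ * (p₂ + (x * u₂ + y * v₂)) + n₃ * (p₃ + (x * u₃ + y * v₃)) ≡
   n₁ * p₁ + n₂ * p₂ + n₃ * p₃)
  ∋ solve (p₁ ∷ p₂ ∷ p₃ ∷ u₁ ∷ u₂ ∷ u₃ ∷ v₁ ∷ v₂ ∷ v₃ ∷ x ∷ y ∷ [])

dot-frame : ∀ P u v w Y → dot (cross u v) (P +₃ apply (frame u v w) Y) ≡ dot (cross u v) P + det3 u v w * proj₂ (proj₂ Y)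
dot-frame (p₁ , p₂ , p₃) (u₁ , u₂ , u₃) (v₁ , v₂ , v₃) (w₁ , w₂ , w₃) (y₁ , y₂ , y₃) =
  let n₁ = u₂ * v₃ - u₃ * v₂ ; n₂ = u₃ * v₁ - u₁ * v₃ ; n₃ = u₁ * v₂ - u₂ * v₁ in
  (n₁ * (p₁ + (u₁ * y₁ + v₁ * y₂ + w₁ * y₃)) + n₂ * (p₂ + (u₂ * y₁ + v₂ * y₂ + w₂ * y₃)) +
   n₃ * (p₃ + (u₃ * y₁ + v₃ * y₂ + w₃ * y₃)) ≡
   n₁ * p₁ + n₂ * p₂ + n₃ * p₃ + (u₁ * (v₂ * w₃ - v₃ * w₂) + u₂ * (v₃ * w₁ - v₁ * w₃) + u₃ * (v₁ * w₂ - v₂ * w₁)) * y₃)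
  ∋ solve (p₁ ∷ p₂ ∷ p₃ ∷ u₁ ∷ u₂ ∷ u₃ ∷ v₁ ∷ v₂ ∷ v₃ ∷ w₁ ∷ w₂ ∷ w₃ ∷ y₁ ∷ y₂ ∷ y₃ ∷ [])

base-normal : ∀ P u v a b c x →
  dot (cross (affMap2 P u v b -₃ affMap2 P u v a) (affMap2 P u v c -₃ affMap2 P u v a)) (x -₃ affMap2 P u v a) ≡
  det₂ a b c * dot (cross u v) (x -₃ P)
base-normal (p₁ , p₂ , p₃) (u₁ , u₂ , u₃) (v₁ , v₂ , v₃) (a₁ , a₂) (b₁ , b₂) (c₁ , c₂) (x₁ , x₂ , x₃) =
  let A₁ = p₁ + (a₁ * u₁ + a₂ * v₁) ; A₂ = p₂ + (a₁ * u₂ + a₂ * v₂) ; A₃ = p₃ + (a₁ * u₃ + a₂ * v₃)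
      e₁ = p₁ + (b₁ * u₁ + b₂ * v₁) - A₁ ; e₂ = p₂ + (b₁ * u₂ + b₂ * v₂) - A₂ ; e₃ = p₃ + (b₁ * u₃ + b₂ * v₃) - A₃
      f₁ = p₁ + (c₁ * u₁ + c₂ * v₁) - A₁ ; f₂ = p₂ + (c₁ * u₂ + c₂ * v₂) - A₂ ; f₃ = p₃ + (c₁ * u₃ + c₂ * v₃) - A₃
  in ((e₂ * f₃ - e₃ * f₂) * (x₁ - A₁) + (e₃ * f₁ - e₁ * f₃) * (x₂ - A₂) + (e₁ * f₂ - e₂ * f₁) * (x₃ - A₃) ≡
      ((b₁ - a₁) * (c₂ - a₂) - (b₂ - a₂) * (c₁ - a₁)) *
      ((u₂ * v₃ - u₃ * v₂) * (x₁ - p₁) + (u₃ * v₁ - u₁ * v₃) * (x₂ - p₂) + (u₁ * v₂ - u₂ * v₁) * (x₃ - p₃)))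
     ∋ solve (p₁ ∷ p₂ ∷ p₃ ∷ u₁ ∷ u₂ ∷ u₃ ∷ v₁ ∷ v₂ ∷ v₃ ∷ a₁ ∷ a₂ ∷ b₁ ∷ b₂ ∷ c₁ ∷ c₂ ∷ x₁ ∷ x₂ ∷ x₃ ∷ [])

frame-decomposition : ∀ P u v w y p₁ p₂ q → affMap2 P u v (p₁ , p₂) ≡ P +₃ (y -₃ (q ·₃ w)) →
  y ≡ apply (frame u v w) (p₁ , p₂ , q)
frame-decomposition P@(P₁ , P₂ , P₃) u@(u₁ , u₂ , u₃) v@(v₁ , v₂ , v₃) w@(w₁ , w₂ , w₃) y@(y₁ , y₂ , y₃) p₁ p₂ q e = begin
  y                                              ≡⟨ ≡₃ (regroup P₁ y₁ w₁) (regroup P₂ y₂ w₂) (regroup P₃ y₃ w₃) ⟩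
  ((P +₃ (y -₃ (q ·₃ w))) -₃ P) +₃ (q ·₃ w)      ≡⟨ cong (λ x → (x -₃ P) +₃ (q ·₃ w)) e ⟨
  (affMap2 P u v (p₁ , p₂) -₃ P) +₃ (q ·₃ w)     ≡⟨ ≡₃ (coordinates P₁ u₁ v₁ w₁) (coordinates P₂ u₂ v₂ w₂) (coordinates P₃ u₃ v₃ w₃) ⟩
  apply (frame u v w) (p₁ , p₂ , q)              ∎
  where
  open ≡-Reasoning
  regroup : ∀ p y w → y ≡ p + (y - q * w) - p + q * w
  regroup p y w = solve (p ∷ y ∷ w ∷ q ∷ [])
  coordinates : ∀ p u v w → p + (p₁ * u + p₂ * v) - p + q * w ≡ u * p₁ + v * p₂ + w * q
  coordinates p u v w = solve (p ∷ u ∷ v ∷ w ∷ p₁ ∷ p₂ ∷ q ∷ [])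

frame-coframe-point : ∀ P u v w x → det3 u v w ≡ + 1 → x ≡ P +₃ apply (frame u v w) (apply (coframe u v w) (x -₃ P))
frame-coframe-point P@(p₁ , p₂ , p₃) u v w x@(x₁ , x₂ , x₃) det≡1 = begin
  x                                 ≡⟨ ≡₃ (recentre p₁ x₁) (recentre p₂ x₂) (recentre p₃ x₃) ⟩
  P +₃ ((+ 1) ·₃ (x -₃ P))          ≡⟨ cong (λ d → P +₃ (d ·₃ (x -₃ P))) det≡1 ⟨
  P +₃ (det3 u v w ·₃ (x -₃ P))     ≡⟨ cong (P +₃_) (frame-coframe u v w (x -₃ P)) ⟨
  P +₃ apply (frame u v w) (apply (coframe u v w) (x -₃ P)) ∎
  where
  open ≡-Reasoning
  recentre : ∀ p x → x ≡ p + + 1 * (x - p)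
  recentre p x = solve (p ∷ x ∷ [])

plane-coordinate : ∀ (p x u v w g ζ₁ ζ₂ a₁ a₂ b₁ b₂ c₁ c₂ : ℤ) → g * (x - p) ≡ u * ζ₁ + v * ζ₂ + w * 0ℤ →
  let δ = (b₁ - a₁) * (c₂ - a₂) - (b₂ - a₂) * (c₁ - a₁) ; A = p + (a₁ * u + a₂ * v)
      σ = (ζ₁ - g * a₁) * (c₂ - a₂) - (ζ₂ - g * a₂) * (c₁ - a₁)
      τ = (ζ₂ - g * a₂) * (b₁ - a₁) - (ζ₁ - g * a₁) * (b₂ - a₂)
  in (g * δ) * x ≡ (g * δ) * A + (σ * (p + (b₁ * u + b₂ * v) - A) + τ * (p + (c₁ * u + c₂ * v) - A))
plane-coordinate p x u v w g ζ₁ ζ₂ a₁ a₂ b₁ b₂ c₁ c₂ e =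
  linear-combination₁ ((b₁ - a₁) * (c₂ - a₂) - (b₂ - a₂) * (c₁ - a₁)) e
    (solve (p ∷ x ∷ u ∷ v ∷ w ∷ g ∷ ζ₁ ∷ ζ₂ ∷ a₁ ∷ a₂ ∷ b₁ ∷ b₂ ∷ c₁ ∷ c₂ ∷ []))

-- σ and τ come from solving B - A = (b - a)·(u , v) and C - A = (c - a)·(u , v) for δ u and δ v.
plane-combination : ∀ P u v w a b c x g ζ₁ ζ₂ →
  g ·₃ (x -₃ P) ≡ apply (frame u v w) (ζ₁ , ζ₂ , 0ℤ) →
  let δ = det₂ a b c ; A = affMap2 P u v a
      σ = (ζ₁ - g * proj₁ a) * (proj₂ c - proj₂ a) - (ζ₂ - g * proj₂ a) * (proj₁ c - proj₁ a)
      τ = (ζ₂ - g * proj₂ a) * (proj₁ b - proj₁ a) - (ζ₁ - g * proj₁ a) * (proj₂ b - proj₂ a)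
  in (g * δ) ·₃ x ≡ ((g * δ) ·₃ A) +₃ ((σ ·₃ (affMap2 P u v b -₃ A)) +₃ (τ ·₃ (affMap2 P u v c -₃ A)))
plane-combination (p₁ , p₂ , p₃) (u₁ , u₂ , u₃) (v₁ , v₂ , v₃) (w₁ , w₂ , w₃) (a₁ , a₂) (b₁ , b₂) (c₁ , c₂)
                  (x₁ , x₂ , x₃) g ζ₁ ζ₂ e =
  ≡₃ (plane-coordinate p₁ x₁ u₁ v₁ w₁ g ζ₁ ζ₂ a₁ a₂ b₁ b₂ c₁ c₂ (cong proj₁ e))
     (plane-coordinate p₂ x₂ u₂ v₂ w₂ g ζ₁ ζ₂ a₁ a₂ b₁ b₂ c₁ c₂ (cong (proj₁ ∘ proj₂) e))
     (plane-coordinate p₃ x₃ u₃ v₃ w₃ g ζ₁ ζ₂ a₁ a₂ b₁ b₂ c₁ c₂ (cong (proj₂ ∘ proj₂) e))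

-- The apex is o = p + α u + β v + s l w, so the total weight enters with the coefficient o - p.
pyramid-coordinate : ∀ (p u v w d l q₁ q₂ s α β n₁ n₂ n₃ a₁ a₂ b₁ b₂ c₁ c₂ : ℤ) →
  n₁ + n₂ + n₃ + d ≡ d * l → n₁ * a₁ + n₂ * b₁ + n₃ * c₁ + d * α ≡ d * l * q₁ →
  n₁ * a₂ + n₂ * b₂ + n₃ * c₂ + d * β ≡ d * l * q₂ →
  let o = p + (u * α + v * β + w * (s * l)) in
  (d * l) * (p + (u * q₁ + v * q₂ + w * s)) ≡
  (d * l) * o + (n₁ * (p + (a₁ * u + a₂ * v) - o) + (n₂ * (p + (b₁ * u + b₂ * v) - o) + n₃ * (p + (c₁ * u + c₂ * v) - o)))
pyramid-coordinate p u v w d l q₁ q₂ s α β n₁ n₂ n₃ a₁ a₂ b₁ b₂ c₁ c₂ total first second =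
  linear-combination₃ (u * α + v * β + w * (s * l)) (- u) (- v) total first second
    (solve (p ∷ u ∷ v ∷ w ∷ d ∷ l ∷ q₁ ∷ q₂ ∷ s ∷ α ∷ β ∷ n₁ ∷ n₂ ∷ n₃ ∷ a₁ ∷ a₂ ∷ b₁ ∷ b₂ ∷ c₁ ∷ c₂ ∷ []))

pyramid-combination : ∀ P u v w (a b c : Pt2) (d l q₁ q₂ s α β n₁ n₂ n₃ : ℤ) →
  n₁ + n₂ + n₃ + d ≡ d * l →
  n₁ * proj₁ a + n₂ * proj₁ b + n₃ * proj₁ c + d * α ≡ d * l * q₁ →
  n₁ * proj₂ a + n₂ * proj₂ b + n₃ * proj₂ c + d * β ≡ d * l * q₂ →
  let O = P +₃ apply (frame u v w) (α , β , s * l) in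
  (d * l) ·₃ (P +₃ apply (frame u v w) (q₁ , q₂ , s)) ≡
  ((d * l) ·₃ O) +₃ ((n₁ ·₃ (affMap2 P u v a -₃ O)) +₃ ((n₂ ·₃ (affMap2 P u v b -₃ O)) +₃ (n₃ ·₃ (affMap2 P u v c -₃ O))))
pyramid-combination (p₁ , p₂ , p₃) (u₁ , u₂ , u₃) (v₁ , v₂ , v₃) (w₁ , w₂ , w₃) (a₁ , a₂) (b₁ , b₂) (c₁ , c₂)
                    d l q₁ q₂ s α β n₁ n₂ n₃ total first second =
  ≡₃ (pyramid-coordinate p₁ u₁ v₁ w₁ d l q₁ q₂ s α β n₁ n₂ n₃ a₁ a₂ b₁ b₂ c₁ c₂ total first second)
     (pyramid-coordinate p₂ u₂ v₂ w₂ d l q₁ q₂ s α β n₁ n₂ n₃ a₁ a₂ b₁ b₂ c₁ c₂ total first second)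
     (pyramid-coordinate p₃ u₃ v₃ w₃ d l q₁ q₂ s α β n₁ n₂ n₃ a₁ a₂ b₁ b₂ c₁ c₂ total first second)

-- Rational points of pyramids, planes and triangles

ℚ-ring : ACR.AlmostCommutativeRing _ _
ℚ-ring = ACR.fromCommutativeRing ℚP.+-*-commutativeRing (λ _ → nothing)

toℚᵘ-ι : ∀ x → ℚ.toℚᵘ (ι x) ≃ᵘ mkℚᵘ x 0
toℚᵘ-ι x = ℚP.toℚᵘ-fromℚᵘ (mkℚᵘ x 0)

ι-injective : ∀ {x y} → ι x ≡ ι y → x ≡ y
ι-injective {x} {y} e with ℚᵘP.≃-trans (ℚᵘP.≃-sym (toℚᵘ-ι x)) (ℚᵘP.≃-trans (ℚP.toℚᵘ-cong e) (toℚᵘ-ι y))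
... | *≡* x*1≡y*1 = trans (sym (ℤP.*-identityʳ x)) (trans x*1≡y*1 (ℤP.*-identityʳ y))

ι-+ : ∀ x y → ι (x + y) ≡ ι x ℚ.+ ι y
ι-+ x y = ℚP.toℚᵘ-injective (begin
  ℚ.toℚᵘ (ι (x + y))                ≈⟨ toℚᵘ-ι (x + y) ⟩
  mkℚᵘ (x + y) 0                     ≈⟨ *≡* (((x + y) * + 1 ≡ (x * + 1 + y * + 1) * + 1) ∋ solve (x ∷ y ∷ [])) ⟩
  mkℚᵘ x 0 ℚᵘ.+ mkℚᵘ y 0             ≈⟨ ℚᵘP.+-cong (toℚᵘ-ι x) (toℚᵘ-ι y) ⟨
  ℚ.toℚᵘ (ι x) ℚᵘ.+ ℚ.toℚᵘ (ι y)     ≈⟨ ℚP.toℚᵘ-homo-+ (ι x) (ι y) ⟨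
  ℚ.toℚᵘ (ι x ℚ.+ ι y)               ∎)
  where open ℚᵘP.≃-Reasoning

ι-* : ∀ x y → ι (x * y) ≡ ι x ℚ.* ι y
ι-* x y = ℚP.toℚᵘ-injective (begin
  ℚ.toℚᵘ (ι (x * y))                ≈⟨ toℚᵘ-ι (x * y) ⟩
  mkℚᵘ (x * y) 0                     ≈⟨ *≡* refl ⟩
  mkℚᵘ x 0 ℚᵘ.* mkℚᵘ y 0             ≈⟨ ℚᵘP.*-cong (toℚᵘ-ι x) (toℚᵘ-ι y) ⟨
  ℚ.toℚᵘ (ι x) ℚᵘ.* ℚ.toℚᵘ (ι y)     ≈⟨ ℚP.toℚᵘ-homo-* (ι x) (ι y) ⟨
  ℚ.toℚᵘ (ι x ℚ.* ι y)               ∎)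
  where open ℚᵘP.≃-Reasoning

ι-mono-≤ : ∀ {x y} → x ℤ.≤ y → ι x ℚ.≤ ι y
ι-mono-≤ {x} {y} x≤y = ℚP.toℚᵘ-cancel-≤
  (ℚᵘP.≤-respˡ-≃ (ℚᵘP.≃-sym (toℚᵘ-ι x)) (ℚᵘP.≤-respʳ-≃ (ℚᵘP.≃-sym (toℚᵘ-ι y))
    (*≤* (ℤP.*-monoʳ-≤-nonNeg (+ 1) x≤y))))

ι3-+ : ∀ x y → ι3 (x +₃ y) ≡ ι3 x +q ι3 y
ι3-+ (x₁ , x₂ , x₃) (y₁ , y₂ , y₃) = cong₂ _,_ (ι-+ x₁ y₁) (cong₂ _,_ (ι-+ x₂ y₂) (ι-+ x₃ y₃))

ι3-· : ∀ k x → ι3 (k ·₃ x) ≡ ι k ·q ι3 x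
ι3-· k (x₁ , x₂ , x₃) = cong₂ _,_ (ι-* k x₁) (cong₂ _,_ (ι-* k x₂) (ι-* k x₃))

dotq : Q3 → Q3 → ℚ
dotq (a₁ , a₂ , a₃) (b₁ , b₂ , b₃) = a₁ ℚ.* b₁ ℚ.+ a₂ ℚ.* b₂ ℚ.+ a₃ ℚ.* b₃

ι-dot : ∀ n x → ι (dot n x) ≡ dotq (ι3 n) (ι3 x)
ι-dot (n₁ , n₂ , n₃) (x₁ , x₂ , x₃) =
  trans (ι-+ (n₁ * x₁ + n₂ * x₂) (n₃ * x₃))
    (cong₂ ℚ._+_ (trans (ι-+ (n₁ * x₁) (n₂ * x₂)) (cong₂ ℚ._+_ (ι-* n₁ x₁) (ι-* n₂ x₂))) (ι-* n₃ x₃))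

dotq-combination : ∀ n x y z a b c →
  dotq n ((a ·q x) +q ((b ·q y) +q (c ·q z))) ≡ a ℚ.* dotq n x ℚ.+ (b ℚ.* dotq n y ℚ.+ c ℚ.* dotq n z)
dotq-combination (n₁ , n₂ , n₃) (x₁ , x₂ , x₃) (y₁ , y₂ , y₃) (z₁ , z₂ , z₃) a b c =
  (n₁ ℚ.* (a ℚ.* x₁ ℚ.+ (b ℚ.* y₁ ℚ.+ c ℚ.* z₁)) ℚ.+ n₂ ℚ.* (a ℚ.* x₂ ℚ.+ (b ℚ.* y₂ ℚ.+ c ℚ.* z₂)) ℚ.+
   n₃ ℚ.* (a ℚ.* x₃ ℚ.+ (b ℚ.* y₃ ℚ.+ c ℚ.* z₃)) ≡
   a ℚ.* (n₁ ℚ.* x₁ ℚ.+ n₂ ℚ.* x₂ ℚ.+ n₃ ℚ.* x₃) ℚ.+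
   (b ℚ.* (n₁ ℚ.* y₁ ℚ.+ n₂ ℚ.* y₂ ℚ.+ n₃ ℚ.* y₃) ℚ.+ c ℚ.* (n₁ ℚ.* z₁ ℚ.+ n₂ ℚ.* z₂ ℚ.+ n₃ ℚ.* z₃)))
  ∋ RingSolver.solve (n₁ ∷ n₂ ∷ n₃ ∷ x₁ ∷ x₂ ∷ x₃ ∷ y₁ ∷ y₂ ∷ y₃ ∷ z₁ ∷ z₂ ∷ z₃ ∷ a ∷ b ∷ c ∷ []) ℚ-ring

cancel-factor : ∀ {d κ x o y : ℚ} → κ ℚ.* d ≡ 1ℚ → d ℚ.* x ≡ d ℚ.* o ℚ.+ y → x ≡ o ℚ.+ κ ℚ.* y
cancel-factor {d} {κ} {x} {o} {y} κd≡1 e = begin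
  x                              ≡⟨ ℚP.*-identityˡ x ⟨
  1ℚ ℚ.* x                       ≡⟨ cong (ℚ._* x) κd≡1 ⟨
  κ ℚ.* d ℚ.* x                  ≡⟨ ℚP.*-assoc κ d x ⟩
  κ ℚ.* (d ℚ.* x)                ≡⟨ cong (κ ℚ.*_) e ⟩
  κ ℚ.* (d ℚ.* o ℚ.+ y)          ≡⟨ ℚP.*-distribˡ-+ κ (d ℚ.* o) y ⟩
  κ ℚ.* (d ℚ.* o) ℚ.+ κ ℚ.* y    ≡⟨ cong (ℚ._+ κ ℚ.* y) (ℚP.*-assoc κ d o) ⟨
  κ ℚ.* d ℚ.* o ℚ.+ κ ℚ.* y      ≡⟨ cong (λ r → r ℚ.* o ℚ.+ κ ℚ.* y) κd≡1 ⟩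
  1ℚ ℚ.* o ℚ.+ κ ℚ.* y           ≡⟨ cong (ℚ._+ κ ℚ.* y) (ℚP.*-identityˡ o) ⟩
  o ℚ.+ κ ℚ.* y                  ∎
  where open ≡-Reasoning

cancel-scalar : ∀ {d κ : ℚ} (X O Y : Q3) → κ ℚ.* d ≡ 1ℚ → d ·q X ≡ (d ·q O) +q Y → X ≡ O +q (κ ·q Y)
cancel-scalar {d} {κ} (x₁ , x₂ , x₃) (o₁ , o₂ , o₃) (y₁ , y₂ , y₃) κd≡1 e =
  ≡₃ (cancel-factor {d} {κ} {x₁} {o₁} {y₁} κd≡1 (cong proj₁ e))
     (cancel-factor {d} {κ} {x₂} {o₂} {y₂} κd≡1 (cong (proj₁ ∘ proj₂) e))
     (cancel-factor {d} {κ} {x₃} {o₃} {y₃} κd≡1 (cong (proj₂ ∘ proj₂) e))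

distribute₃ : ∀ (κ w₁ w₂ w₃ a b c : ℚ) →
  κ ℚ.* (w₁ ℚ.* a ℚ.+ (w₂ ℚ.* b ℚ.+ w₃ ℚ.* c)) ≡ w₁ ℚ.* κ ℚ.* a ℚ.+ (w₂ ℚ.* κ ℚ.* b ℚ.+ w₃ ℚ.* κ ℚ.* c)
distribute₃ = RingSolver.solve-∀ ℚ-ring

distribute₂ : ∀ (κ w₁ w₂ a b : ℚ) → κ ℚ.* (w₁ ℚ.* a ℚ.+ w₂ ℚ.* b) ≡ w₁ ℚ.* κ ℚ.* a ℚ.+ w₂ ℚ.* κ ℚ.* b
distribute₂ = RingSolver.solve-∀ ℚ-ring

scale-combination₃ : ∀ κ w₁ w₂ w₃ a b c →
  κ ·q ((w₁ ·q a) +q ((w₂ ·q b) +q (w₃ ·q c))) ≡ ((w₁ ℚ.* κ) ·q a) +q (((w₂ ℚ.* κ) ·q b) +q ((w₃ ℚ.* κ) ·q c))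
scale-combination₃ κ w₁ w₂ w₃ (a₁ , a₂ , a₃) (b₁ , b₂ , b₃) (c₁ , c₂ , c₃) =
  ≡₃ (distribute₃ κ w₁ w₂ w₃ a₁ b₁ c₁) (distribute₃ κ w₁ w₂ w₃ a₂ b₂ c₂) (distribute₃ κ w₁ w₂ w₃ a₃ b₃ c₃)

scale-combination₂ : ∀ κ w₁ w₂ a b → κ ·q ((w₁ ·q a) +q (w₂ ·q b)) ≡ ((w₁ ℚ.* κ) ·q a) +q ((w₂ ℚ.* κ) ·q b)
scale-combination₂ κ w₁ w₂ (a₁ , a₂ , a₃) (b₁ , b₂ , b₃) =
  ≡₃ (distribute₂ κ w₁ w₂ a₁ b₁) (distribute₂ κ w₁ w₂ a₂ b₂) (distribute₂ κ w₁ w₂ a₃ b₃)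

ι3-combination : ∀ k O n₁ n₂ n₃ x y z →
  ι3 ((k ·₃ O) +₃ ((n₁ ·₃ x) +₃ ((n₂ ·₃ y) +₃ (n₃ ·₃ z)))) ≡
  (ι k ·q ι3 O) +q ((ι n₁ ·q ι3 x) +q ((ι n₂ ·q ι3 y) +q (ι n₃ ·q ι3 z)))
ι3-combination k O n₁ n₂ n₃ x y z =
  trans (ι3-+ (k ·₃ O) _) (cong₂ _+q_ (ι3-· k O)
    (trans (ι3-+ (n₁ ·₃ x) _) (cong₂ _+q_ (ι3-· n₁ x)
      (trans (ι3-+ (n₂ ·₃ y) (n₃ ·₃ z)) (cong₂ _+q_ (ι3-· n₂ y) (ι3-· n₃ z))))))

ι-≢0 : ∀ {d} → d ≢ 0ℤ → ι d ≢ 0ℚ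
ι-≢0 d≢0 ιd≡0 = d≢0 (ι-injective ιd≡0)

inPyramid-intro : ∀ {O A B C X : Pt3} (k : ℕ) .{{_ : ℕ.NonZero k}} {n₁ n₂ n₃ : ℤ} →
  0ℤ ℤ.≤ n₁ → 0ℤ ℤ.≤ n₂ → 0ℤ ℤ.≤ n₃ → n₁ + n₂ + n₃ ℤ.≤ + k →
  (+ k) ·₃ X ≡ ((+ k) ·₃ O) +₃ ((n₁ ·₃ (A -₃ O)) +₃ ((n₂ ·₃ (B -₃ O)) +₃ (n₃ ·₃ (C -₃ O)))) →
  InPyramid O A B C X
inPyramid-intro {O} {A} {B} {C} {X} k {n₁} {n₂} {n₃} 0≤n₁ 0≤n₂ 0≤n₃ sum≤k e =
  weight n₁ , weight n₂ , weight n₃ , weight-nonNeg 0≤n₁ , weight-nonNeg 0≤n₂ , weight-nonNeg 0≤n₃ ,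
  weights≤1 , trans (cancel-scalar {ι (+ k)} {κ} (ι3 X) (ι3 O) Y κk≡1 ιe) (combination (ι3 (A -₃ O)) (ι3 (B -₃ O)) (ι3 (C -₃ O)))
  where
  instance
    ιk-positive : ℚ.Positive (ι (+ k))
    ιk-positive = ℚP.normalize-pos k 1
    ιk-nonZero : ℚ.NonZero (ι (+ k))
    ιk-nonZero = ℚP.pos⇒nonZero (ι (+ k))
    κ-nonNeg : ℚ.NonNegative (ℚ.1/ ι (+ k))
    κ-nonNeg = ℚP.pos⇒nonNeg (ℚ.1/ ι (+ k)) {{ℚP.1/pos⇒pos (ι (+ k))}}
  κ : ℚ
  κ = ℚ.1/ ι (+ k)
  κk≡1 : κ ℚ.* ι (+ k) ≡ 1ℚ
  κk≡1 = ℚP.*-inverseˡ (ι (+ k))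
  weight : ℤ → ℚ
  weight n = ι n ℚ.* κ
  weight-nonNeg : ∀ {n} → 0ℤ ℤ.≤ n → 0ℚ ℚ.≤ weight n
  weight-nonNeg {n} 0≤n = subst (ℚ._≤ weight n) (ℚP.*-zeroˡ κ) (ℚP.*-monoʳ-≤-nonNeg κ {ι 0ℤ} {ι n} (ι-mono-≤ 0≤n))
  weights≤1 : weight n₁ ℚ.+ weight n₂ ℚ.+ weight n₃ ℚ.≤ 1ℚ
  weights≤1 = subst₂ ℚ._≤_ distribute (ℚP.*-inverseʳ (ι (+ k))) (ℚP.*-monoʳ-≤-nonNeg κ {ι (n₁ + n₂ + n₃)} {ι (+ k)} (ι-mono-≤ sum≤k))
    where
    distribute : ι (n₁ + n₂ + n₃) ℚ.* κ ≡ weight n₁ ℚ.+ weight n₂ ℚ.+ weight n₃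
    distribute = begin
      ι (n₁ + n₂ + n₃) ℚ.* κ                 ≡⟨ cong (ℚ._* κ) (trans (ι-+ (n₁ + n₂) n₃) (cong (ℚ._+ ι n₃) (ι-+ n₁ n₂))) ⟩
      (ι n₁ ℚ.+ ι n₂ ℚ.+ ι n₃) ℚ.* κ         ≡⟨ ℚP.*-distribʳ-+ κ (ι n₁ ℚ.+ ι n₂) (ι n₃) ⟩
      (ι n₁ ℚ.+ ι n₂) ℚ.* κ ℚ.+ ι n₃ ℚ.* κ   ≡⟨ cong (ℚ._+ weight n₃) (ℚP.*-distribʳ-+ κ (ι n₁) (ι n₂)) ⟩
      weight n₁ ℚ.+ weight n₂ ℚ.+ weight n₃  ∎
      where open ≡-Reasoning
  Y : Q3
  Y = (ι n₁ ·q ι3 (A -₃ O)) +q ((ι n₂ ·q ι3 (B -₃ O)) +q (ι n₃ ·q ι3 (C -₃ O)))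
  ιe : ι (+ k) ·q ι3 X ≡ (ι (+ k) ·q ι3 O) +q Y
  ιe = begin
    ι (+ k) ·q ι3 X  ≡⟨ ι3-· (+ k) X ⟨
    ι3 ((+ k) ·₃ X)    ≡⟨ cong ι3 e ⟩
    ι3 (((+ k) ·₃ O) +₃ ((n₁ ·₃ (A -₃ O)) +₃ ((n₂ ·₃ (B -₃ O)) +₃ (n₃ ·₃ (C -₃ O)))))
      ≡⟨ ι3-combination (+ k) O n₁ n₂ n₃ (A -₃ O) (B -₃ O) (C -₃ O) ⟩
    (ι (+ k) ·q ι3 O) +q Y ∎
    where open ≡-Reasoning
  combination : ∀ a b c → ι3 O +q (κ ·q ((ι n₁ ·q a) +q ((ι n₂ ·q b) +q (ι n₃ ·q c)))) ≡
                          ι3 O +q ((weight n₁ ·q a) +q ((weight n₂ ·q b) +q (weight n₃ ·q c)))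
  combination a b c = cong (ι3 O +q_) (scale-combination₃ κ (ι n₁) (ι n₂) (ι n₃) a b c)

inPlane-intro : ∀ {A B C X : Pt3} (d : ℤ) {s t : ℤ} → d ≢ 0ℤ →
  d ·₃ X ≡ (d ·₃ A) +₃ ((s ·₃ (B -₃ A)) +₃ (t ·₃ (C -₃ A))) → InPlane A B C (ι3 X)
inPlane-intro {A} {B} {C} {X} d {s} {t} d≢0 e =
  ι s ℚ.* κ , ι t ℚ.* κ ,
  trans (cancel-scalar {ι d} {κ} (ι3 X) (ι3 A) Y (ℚP.*-inverseˡ (ι d)) ιe)
        (cong (ι3 A +q_) (scale-combination₂ κ (ι s) (ι t) (ι3 (B -₃ A)) (ι3 (C -₃ A))))
  where
  instance
    ιd-nonZero : ℚ.NonZero (ι d)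
    ιd-nonZero = ℚ.≢-nonZero (ι-≢0 d≢0)
  κ : ℚ
  κ = ℚ.1/ ι d
  Y : Q3
  Y = (ι s ·q ι3 (B -₃ A)) +q (ι t ·q ι3 (C -₃ A))
  ιe : ι d ·q ι3 X ≡ (ι d ·q ι3 A) +q Y
  ιe = begin
    ι d ·q ι3 X   ≡⟨ ι3-· d X ⟨
    ι3 (d ·₃ X)   ≡⟨ cong ι3 e ⟩
    ι3 ((d ·₃ A) +₃ ((s ·₃ (B -₃ A)) +₃ (t ·₃ (C -₃ A))))
      ≡⟨ trans (ι3-+ (d ·₃ A) _) (cong₂ _+q_ (ι3-· d A)
           (trans (ι3-+ (s ·₃ (B -₃ A)) (t ·₃ (C -₃ A))) (cong₂ _+q_ (ι3-· s (B -₃ A)) (ι3-· t (C -₃ A))))) ⟩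
    (ι d ·q ι3 A) +q Y ∎
    where open ≡-Reasoning

inTriangle-level : ∀ {A B C X : Pt3} (n : Pt3) {z : ℤ} → InTriangle A B C X →
  dot n A ≡ z → dot n B ≡ z → dot n C ≡ z → dot n X ≡ z
inTriangle-level {A} {B} {C} {X} n {z} (a , b , c , _ , _ , _ , a+b+c≡1 , eX) nA≡z nB≡z nC≡z = ι-injective (begin
  ι (dot n X)                                        ≡⟨ ι-dot n X ⟩
  dotq (ι3 n) (ι3 X)                                 ≡⟨ cong (dotq (ι3 n)) eX ⟩
  dotq (ι3 n) ((a ·q ι3 A) +q ((b ·q ι3 B) +q (c ·q ι3 C)))
    ≡⟨ dotq-combination (ι3 n) (ι3 A) (ι3 B) (ι3 C) a b c ⟩
  a ℚ.* dotq (ι3 n) (ι3 A) ℚ.+ (b ℚ.* dotq (ι3 n) (ι3 B) ℚ.+ c ℚ.* dotq (ι3 n) (ι3 C))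
    ≡⟨ cong₂ (λ p q → a ℚ.* p ℚ.+ q) (on-level nA≡z) (cong₂ (λ p q → b ℚ.* p ℚ.+ c ℚ.* q) (on-level nB≡z) (on-level nC≡z)) ⟩
  a ℚ.* ι z ℚ.+ (b ℚ.* ι z ℚ.+ c ℚ.* ι z)            ≡⟨ factor a b c (ι z) ⟩
  (a ℚ.+ b ℚ.+ c) ℚ.* ι z                            ≡⟨ cong (ℚ._* ι z) a+b+c≡1 ⟩
  1ℚ ℚ.* ι z                                         ≡⟨ ℚP.*-identityˡ (ι z) ⟩
  ι z                                                ∎)
  where
  open ≡-Reasoning
  on-level : ∀ {V} → dot n V ≡ z → dotq (ι3 n) (ι3 V) ≡ ι z
  on-level {V} nV≡z = trans (sym (ι-dot n V)) (cong ι nV≡z)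
  factor : ∀ a b c x → a ℚ.* x ℚ.+ (b ℚ.* x ℚ.+ c ℚ.* x) ≡ (a ℚ.+ b ℚ.+ c) ℚ.* x
  factor = RingSolver.solve-∀ ℚ-ring

-- Orderings of the base vertices

data Arrangement {X : Set} (x y z : X) : X → X → X → Set where
  xyz : Arrangement x y z x y z
  xzy : Arrangement x y z x z y
  yxz : Arrangement x y z y x z
  yzx : Arrangement x y z y z x
  zxy : Arrangement x y z z x y
  zyx : Arrangement x y z z y x

↭-singleton : ∀ {X : Set} {y c : X} → (y ∷ []) ↭ (c ∷ []) → c ≡ y
↭-singleton p = ∷-injectiveˡ (↭-singleton-inv (↭-sym p))

↭-pair : ∀ {X : Set} {y z b c : X} → (y ∷ z ∷ []) ↭ (b ∷ c ∷ []) → (b ≡ y × c ≡ z) ⊎ (b ≡ z × c ≡ y)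
↭-pair {y = y} {z} p with ∈-resp-↭ (↭-sym p) (here refl)
... | here refl         = inj₁ (refl , ↭-singleton (drop-∷ p))
... | there (here refl) = inj₂ (refl , ↭-singleton (drop-∷ (↭-trans (swap z y ↭-refl) p)))

↭-arrangement : ∀ {X : Set} {x y z a b c : X} → (x ∷ y ∷ z ∷ []) ↭ (a ∷ b ∷ c ∷ []) → Arrangement x y z a b c
↭-arrangement {x = x} {y} {z} p with ∈-resp-↭ (↭-sym p) (here refl)
... | here refl with ↭-pair (drop-∷ p)
...   | inj₁ (refl , refl) = xyz
...   | inj₂ (refl , refl) = xzy
↭-arrangement {x = x} {y} {z} p | there (here refl) with ↭-pair (drop-∷ (↭-trans (swap y x ↭-refl) p))
...   | inj₁ (refl , refl) = yxz
...   | inj₂ (refl , refl) = yzx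
↭-arrangement {x = x} {y} {z} p | there (there (here refl))
  with ↭-pair (drop-∷ (↭-trans (↭-trans (swap z x ↭-refl) (prep x (swap z y ↭-refl))) p))
...   | inj₁ (refl , refl) = zxy
...   | inj₂ (refl , refl) = zyx

arrangement-preimage : ∀ {X Y : Set} (f : X → Y) {x y z : X} {A B C : Y} → Arrangement (f x) (f y) (f z) A B C →
  ∃[ a ] ∃[ b ] ∃[ c ] (Arrangement x y z a b c × f a ≡ A × f b ≡ B × f c ≡ C)
arrangement-preimage f {x} {y} {z} xyz = x , y , z , xyz , refl , refl , refl
arrangement-preimage f {x} {y} {z} xzy = x , z , y , xzy , refl , refl , refl
arrangement-preimage f {x} {y} {z} yxz = y , x , z , yxz , refl , refl , refl
arrangement-preimage f {x} {y} {z} yzx = y , z , x , yzx , refl , refl , refl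
arrangement-preimage f {x} {y} {z} zxy = z , x , y , zxy , refl , refl , refl
arrangement-preimage f {x} {y} {z} zyx = z , y , x , zyx , refl , refl , refl

-- Lattice points in the slice at height one

-- The lattice point q = (n₁ a + n₂ b + n₃ c + D (α , β)) / (D l) with weights nᵢ ≥ 0 summing to
-- D (l - 1): a lattice point at height one in the pyramid of height l over abc with apex above (α , β).
record SlicePoint (D l : ℕ) (α β : ℤ) (a b c : Pt2) : Set where
  field
    q₁ q₂ n₁ n₂ n₃ : ℤ
    n₁-nonNeg : 0ℤ ℤ.≤ n₁
    n₂-nonNeg : 0ℤ ℤ.≤ n₂
    n₃-nonNeg : 0ℤ ℤ.≤ n₃
    total  : n₁ + n₂ + n₃ + + D ≡ + D * + l
    first  : n₁ * proj₁ a + n₂ * proj₁ b + n₃ * proj₁ c + + D * α ≡ + D * + l * q₁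
    second : n₁ * proj₂ a + n₂ * proj₂ b + n₃ * proj₂ c + + D * β ≡ + D * + l * q₂

SlicePoint-swap₁₂ : ∀ {D l α β a b c} → SlicePoint D l α β a b c → SlicePoint D l α β b a c
SlicePoint-swap₁₂ {D} {l} {α} {β} {a} {b} {c} sp = record
  { q₁ = q₁ ; q₂ = q₂ ; n₁ = n₂ ; n₂ = n₁ ; n₃ = n₃
  ; n₁-nonNeg = n₂-nonNeg ; n₂-nonNeg = n₁-nonNeg ; n₃-nonNeg = n₃-nonNeg
  ; total  = trans (reorder n₁ n₂ n₃ (+ D)) total
  ; first  = trans (reorder (n₁ * proj₁ a) (n₂ * proj₁ b) (n₃ * proj₁ c) (+ D * α)) first
  ; second = trans (reorder (n₁ * proj₂ a) (n₂ * proj₂ b) (n₃ * proj₂ c) (+ D * β)) second }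
  where
  open SlicePoint sp
  reorder : ∀ x y z e → y + x + z + e ≡ x + y + z + e
  reorder x y z e = solve (x ∷ y ∷ z ∷ e ∷ [])

SlicePoint-swap₂₃ : ∀ {D l α β a b c} → SlicePoint D l α β a b c → SlicePoint D l α β a c b
SlicePoint-swap₂₃ {D} {l} {α} {β} {a} {b} {c} sp = record
  { q₁ = q₁ ; q₂ = q₂ ; n₁ = n₁ ; n₂ = n₃ ; n₃ = n₂
  ; n₁-nonNeg = n₁-nonNeg ; n₂-nonNeg = n₃-nonNeg ; n₃-nonNeg = n₂-nonNeg
  ; total  = trans (reorder n₁ n₂ n₃ (+ D)) total
  ; first  = trans (reorder (n₁ * proj₁ a) (n₂ * proj₁ b) (n₃ * proj₁ c) (+ D * α)) first
  ; second = trans (reorder (n₁ * proj₂ a) (n₂ * proj₂ b) (n₃ * proj₂ c) (+ D * β)) second }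
  where
  open SlicePoint sp
  reorder : ∀ x y z e → x + z + y + e ≡ x + y + z + e
  reorder x y z e = solve (x ∷ y ∷ z ∷ e ∷ [])

SlicePoint-arrange : ∀ {D l α β x y z a b c} → Arrangement x y z a b c → SlicePoint D l α β x y z → SlicePoint D l α β a b c
SlicePoint-arrange xyz = λ sp → sp
SlicePoint-arrange xzy = SlicePoint-swap₂₃
SlicePoint-arrange yxz = SlicePoint-swap₁₂
SlicePoint-arrange yzx = λ sp → SlicePoint-swap₂₃ (SlicePoint-swap₁₂ sp)
SlicePoint-arrange zxy = λ sp → SlicePoint-swap₁₂ (SlicePoint-swap₂₃ sp)
SlicePoint-arrange zyx = λ sp → SlicePoint-swap₁₂ (SlicePoint-swap₂₃ (SlicePoint-swap₁₂ sp))

T₁ T₂ T₃ : Pt2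
T₁ = -[1+ 1 ] , + 1
T₂ = -[1+ 0 ] , -[1+ 0 ]
T₃ = + 1 , + 2

Exceptional : ℕ → ℤ → ℤ → Set
Exceptional l α β = l ≡ 2 × ∃[ α′ ] ∃[ β′ ] (α ≡ + 2 * α′ × β ≡ + 2 * β′)

slice-point-equations : ∀ {α β l} L j t r k n₃ q₁ q₂ →
  l ≡ + 1 + L → L ≡ j + (r + t * + 2) → n₃ ≡ + 7 * (j + t) + + 2 * r - + 3 * k →
  α ≡ l * q₁ + (k + t + r - j) → β ≡ l * q₂ + (k - + 2 * j - + 3 * t - r) →
  let n₁ = + 7 * t + + 4 * r + k ; n₂ = + 2 * k + r in
  (n₁ + n₂ + n₃ + + 7 ≡ + 7 * l) ×
  (n₁ * -[1+ 1 ] + n₂ * -[1+ 0 ] + n₃ * + 1 + + 7 * α ≡ + 7 * l * q₁) ×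
  (n₁ * + 1 + n₂ * -[1+ 0 ] + n₃ * + 2 + + 7 * β ≡ + 7 * l * q₂)
slice-point-equations _ j t r k _ q₁ q₂ refl refl refl refl refl = solve vs , solve vs , solve vs
  where
  vs : List ℤ
  vs = j ∷ t ∷ r ∷ k ∷ q₁ ∷ q₂ ∷ []

coordinates-from-residues : ∀ {α β l L j t r k Qa Qb : ℤ} → l ≡ + 1 + L → L ≡ j + (r + t * + 2) →
  β - α - + 2 ≡ j + Qb * l → + 3 * α - + 2 * β - (j + + 9 * t + + 5 * r) ≡ k + Qa * l →
  α ≡ l * (Qa + + 2 * (Qb + + 2)) + (k + t + r - j) × β ≡ l * (Qa + + 3 * (Qb + + 2)) + (k - + 2 * j - + 3 * t - r)
coordinates-from-residues {α} {β} {_} {_} {j} {t} {r} {k} {Qa} {Qb} refl refl e₁ e₂ =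
  linear-combination₂ (+ 2) (+ 1) e₁ e₂ (solve vs) , linear-combination₂ (+ 3) (+ 1) e₁ e₂ (solve vs)
  where
  vs : List ℤ
  vs = α ∷ β ∷ j ∷ t ∷ r ∷ k ∷ Qa ∷ Qb ∷ []

third-weight : ∀ n₃ j t r k k′ → n₃ + r ≡ + 3 * k′ + + 4 * j + t → j + (r + t * + 2) ≡ k + k′ →
  n₃ ≡ + 7 * (j + t) + + 2 * r - + 3 * k
third-weight n₃ j t r k k′ e₁ e₂ =
  linear-combination₂ (+ 1) (- + 3) e₁ e₂ (solve (n₃ ∷ j ∷ t ∷ r ∷ k ∷ k′ ∷ []))

cast-decomposition : ∀ {L j r t : ℕ} → L ≡ j ℕ.+ (r ℕ.+ t ℕ.* 2) → + L ≡ + j + (+ r + + t * + 2)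
cast-decomposition {j = j} {r} {t} e = trans (cong +_ e) (cong (λ x → + j + (+ r + x)) (ℤP.pos-* t 2))

exceptional-residues : ∀ j t r k′ → r ℕ.< 2 → ¬ (r ℕ.≤ 3 ℕ.* k′ ℕ.+ 4 ℕ.* j ℕ.+ t) →
  r ≡ 1 × j ≡ 0 × t ≡ 0 × k′ ≡ 0
exceptional-residues j       t       0             k′       _ r≰ = ⊥-elim (r≰ ℕ.z≤n)
exceptional-residues j       t       (suc (suc r)) k′       (ℕ.s≤s (ℕ.s≤s ())) _
exceptional-residues j       t       1             (suc k′) _ r≰ = ⊥-elim (r≰ (ℕ.s≤s ℕ.z≤n))
exceptional-residues (suc j) t       1             0        _ r≰ = ⊥-elim (r≰ (ℕ.s≤s ℕ.z≤n))
exceptional-residues 0       (suc t) 1             0        _ r≰ = ⊥-elim (r≰ (ℕ.s≤s ℕ.z≤n))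
exceptional-residues 0       0       1             0        _ _  = refl , refl , refl , refl

-- With l = 1 + j + 2t + r and k + k′ = l - 1 the weights are 7t + 4r + k, 2k + r and 3k′ + 4j + t - r;
-- only r = 1, j = t = k′ = 0 makes the last one negative, and then l = 2 and α, β are even.
slice-from-coordinates : ∀ {L′ : ℕ} {α β : ℤ} (j t r k k′ : ℕ) (q₁ q₂ : ℤ) → r ℕ.< 2 →
  suc L′ ≡ j ℕ.+ (r ℕ.+ t ℕ.* 2) → suc L′ ≡ k ℕ.+ k′ →
  α ≡ + (2 ℕ.+ L′) * q₁ + (+ k + + t + + r - + j) →
  β ≡ + (2 ℕ.+ L′) * q₂ + (+ k - + 2 * + j - + 3 * + t - + r) →
  Exceptional (2 ℕ.+ L′) α β ⊎ SlicePoint 7 (2 ℕ.+ L′) α β T₁ T₂ T₃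
slice-from-coordinates {L′} {α} {β} j t r k k′ q₁ q₂ r<2 eL eK hα hβ with r ℕ.≤? 3 ℕ.* k′ ℕ.+ 4 ℕ.* j ℕ.+ t
... | yes r≤ = inj₂ (record
  { q₁ = q₁ ; q₂ = q₂
  ; n₁ = + 7 * + t + + 4 * + r + + k ; n₂ = + 2 * + k + + r ; n₃ = n₃
  ; n₁-nonNeg = subst (0ℤ ℤ.≤_) (cong₂ (λ x y → x + y + + k) (ℤP.pos-* 7 t) (ℤP.pos-* 4 r)) (ℤ.+≤+ ℕ.z≤n)
  ; n₂-nonNeg = subst (0ℤ ℤ.≤_) (cong (_+ + r) (ℤP.pos-* 2 k)) (ℤ.+≤+ ℕ.z≤n)
  ; n₃-nonNeg = ℤ.+≤+ ℕ.z≤n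
  ; total = proj₁ identities ; first = proj₁ (proj₂ identities) ; second = proj₂ (proj₂ identities) })
  where
  n₃+r : + (3 ℕ.* k′ ℕ.+ 4 ℕ.* j ℕ.+ t ℕ.∸ r) + + r ≡ + 3 * + k′ + + 4 * + j + + t
  n₃+r = trans (cong +_ (ℕP.m∸n+n≡m r≤)) (cong₂ (λ x y → x + y + + t) (ℤP.pos-* 3 k′) (ℤP.pos-* 4 j))
  L-cast : + suc L′ ≡ + j + (+ r + + t * + 2)
  L-cast = cast-decomposition {j = j} {r} {t} eL
  n₃ : ℤ
  n₃ = + (3 ℕ.* k′ ℕ.+ 4 ℕ.* j ℕ.+ t ℕ.∸ r)
  identities : let n₁ = + 7 * + t + + 4 * + r + + k ; n₂ = + 2 * + k + + r in
    (n₁ + n₂ + n₃ + + 7 ≡ + 7 * + (2 ℕ.+ L′)) ×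
    (n₁ * -[1+ 1 ] + n₂ * -[1+ 0 ] + n₃ * + 1 + + 7 * α ≡ + 7 * + (2 ℕ.+ L′) * q₁) ×
    (n₁ * + 1 + n₂ * -[1+ 0 ] + n₃ * + 2 + + 7 * β ≡ + 7 * + (2 ℕ.+ L′) * q₂)
  identities = slice-point-equations (+ suc L′) (+ j) (+ t) (+ r) (+ k) n₃ q₁ q₂ refl L-cast
    (third-weight n₃ (+ j) (+ t) (+ r) (+ k) (+ k′) n₃+r (trans (sym L-cast) (cong +_ eK))) hα hβ
... | no r≰ with exceptional-residues j t r k′ r<2 r≰
...   | refl , refl , refl , refl with ℕP.suc-injective eL | trans eK (ℕP.+-identityʳ k)
...     | refl | refl = inj₁ (refl , q₁ + + 1 , q₂ + 0ℤ , even {q = q₁} {+ 1} hα , even {q = q₂} {0ℤ} hβ)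
  where
  even : ∀ {x q c : ℤ} → x ≡ + 2 * q + + 2 * c → x ≡ + 2 * (q + c)
  even {x} {q} {c} e = trans e (solve (x ∷ q ∷ c ∷ []))

slice-dichotomy : ∀ L′ α β → Exceptional (2 ℕ.+ L′) α β ⊎ SlicePoint 7 (2 ℕ.+ L′) α β T₁ T₂ T₃
slice-dichotomy L′ α β =
  slice-from-coordinates j t r k (L ℕ.∸ k) (Qa + + 2 * (Qb + + 2)) (Qa + + 3 * (Qb + + 2))
    (ℕ.m%n<n (L ℕ.∸ j) 2) eL (sym (ℕP.m+[n∸m]≡n k≤L)) (proj₁ coordinates) (proj₂ coordinates)
  where
  l L : ℕ
  l = 2 ℕ.+ L′
  L = suc L′
  j t r k : ℕ
  Qa Qb : ℤ
  j = (β - α - + 2) %ℕ l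
  Qb = (β - α - + 2) /ℕ l
  t = (L ℕ.∸ j) ℕ./ 2
  r = (L ℕ.∸ j) ℕ.% 2
  k = (+ 3 * α - + 2 * β - (+ j + + 9 * + t + + 5 * + r)) %ℕ l
  Qa = (+ 3 * α - + 2 * β - (+ j + + 9 * + t + + 5 * + r)) /ℕ l
  j≤L : j ℕ.≤ L
  j≤L = ℕP.≤-pred (n%ℕd<d (β - α - + 2) l)
  k≤L : k ℕ.≤ L
  k≤L = ℕP.≤-pred (n%ℕd<d (+ 3 * α - + 2 * β - (+ j + + 9 * + t + + 5 * + r)) l)
  eL : L ≡ j ℕ.+ (r ℕ.+ t ℕ.* 2)
  eL = trans (sym (ℕP.m+[n∸m]≡n j≤L)) (cong (j ℕ.+_) (ℕ.m≡m%n+[m/n]*n (L ℕ.∸ j) 2))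
  coordinates : α ≡ + l * (Qa + + 2 * (Qb + + 2)) + (+ k + + t + + r - + j) ×
                β ≡ + l * (Qa + + 3 * (Qb + + 2)) + (+ k - + 2 * + j - + 3 * + t - + r)
  coordinates = coordinates-from-residues {α} {β} {+ l} {+ L} {+ j} {+ t} {+ r} {+ k} {Qa} {Qb} refl (cast-decomposition {L} {j} {r} {t} eL)
    (a≡a%ℕn+[a/ℕn]*n (β - α - + 2) l) (a≡a%ℕn+[a/ℕn]*n (+ 3 * α - + 2 * β - (+ j + + 9 * + t + + 5 * + r)) l)

-- Unimodular frames and the standard pyramid

spanning-frame-unimodular : ∀ u v w {k} → det3 u v w ≡ + suc k → (∀ y → ∃[ Y ] y ≡ apply (frame u v w) Y) → k ≡ 0
spanning-frame-unimodular u v w {k} det≡ span =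
  ℕP.suc-injective (ℕP.m*n≡1⇒m≡1 (suc k) ∣ d ∣ (trans (sym (ℤP.abs-* (+ suc k) d)) (cong ∣_∣ (sym one))))
  where
  open ≡-Reasoning
  F : Pt3 → Pt3
  F = apply (frame u v w)
  e₁ e₂ e₃ : Pt3
  e₁ = + 1 , 0ℤ , 0ℤ
  e₂ = 0ℤ , + 1 , 0ℤ
  e₃ = 0ℤ , 0ℤ , + 1
  Y₁ Y₂ Y₃ : Pt3
  Y₁ = proj₁ (span e₁)
  Y₂ = proj₁ (span e₂)
  Y₃ = proj₁ (span e₃)
  d : ℤ
  d = det3 Y₁ Y₂ Y₃
  one : + 1 ≡ + suc k * d
  one = begin
    det3 e₁ e₂ e₃                ≡⟨ cong₂ (λ x y → det3 x y e₃) (proj₂ (span e₁)) (proj₂ (span e₂)) ⟩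
    det3 (F Y₁) (F Y₂) e₃        ≡⟨ cong (det3 (F Y₁) (F Y₂)) (proj₂ (span e₃)) ⟩
    det3 (F Y₁) (F Y₂) (F Y₃)    ≡⟨ det3-frame u v w Y₁ Y₂ Y₃ ⟩
    det3 u v w * d               ≡⟨ cong (_* d) det≡ ⟩
    + suc k * d                  ∎

unit-multiple : ∀ h {l} → ∣ h ∣ ≡ l → ∃[ s ] (s * s ≡ + 1 × h ≡ s * + l)
unit-multiple (+ n)    refl = + 1 , refl , sym (ℤP.*-identityˡ (+ n))
unit-multiple -[1+ n ] refl = -[1+ 0 ] , refl , sym (ℤP.-1*i≡-i (+ suc n))

-- In frame coordinates the apex (2α′ , 2β′ , 2s) goes to 0 and the base plane to the plane x₁ = 2.
apex-matrix apex-matrix⁻¹ : ℤ → ℤ → ℤ → Mat3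
apex-matrix α′ β′ s = (0ℤ , 0ℤ , - s) , (+ 1 , 0ℤ , - (α′ * s)) , (0ℤ , + 1 , - (β′ * s))
apex-matrix⁻¹ α′ β′ s = (- α′ , + 1 , 0ℤ) , (- β′ , 0ℤ , + 1) , (- s , 0ℤ , 0ℤ)

apex-matrix-inverseˡ : ∀ α′ β′ {s} → s * s ≡ + 1 → ∀ x → apply (apex-matrix⁻¹ α′ β′ s) (apply (apex-matrix α′ β′ s) x) ≡ x
apex-matrix-inverseˡ α′ β′ {s} s²≡1 (x₁ , x₂ , x₃) =
  let y₁ = 0ℤ * x₁ + 0ℤ * x₂ + - s * x₃
      y₂ = + 1 * x₁ + 0ℤ * x₂ + - (α′ * s) * x₃
      y₃ = 0ℤ * x₁ + + 1 * x₂ + - (β′ * s) * x₃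
      vs = α′ ∷ β′ ∷ s ∷ x₁ ∷ x₂ ∷ x₃ ∷ []
  in ≡₃ {x₁ = - α′ * y₁ + + 1 * y₂ + 0ℤ * y₃} { - β′ * y₁ + 0ℤ * y₂ + + 1 * y₃} { - s * y₁ + 0ℤ * y₂ + 0ℤ * y₃}
        (solve vs) (solve vs) (linear-combination₁ x₃ s²≡1 (solve vs))

apex-matrix-inverseʳ : ∀ α′ β′ {s} → s * s ≡ + 1 → ∀ y → apply (apex-matrix α′ β′ s) (apply (apex-matrix⁻¹ α′ β′ s) y) ≡ y
apex-matrix-inverseʳ α′ β′ {s} s²≡1 (y₁ , y₂ , y₃) =
  let z₁ = - α′ * y₁ + + 1 * y₂ + 0ℤ * y₃
      z₂ = - β′ * y₁ + 0ℤ * y₂ + + 1 * y₃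
      z₃ = - s * y₁ + 0ℤ * y₂ + 0ℤ * y₃
      vs = α′ ∷ β′ ∷ s ∷ y₁ ∷ y₂ ∷ y₃ ∷ []
  in ≡₃ {x₁ = 0ℤ * z₁ + 0ℤ * z₂ + - s * z₃} {+ 1 * z₁ + 0ℤ * z₂ + - (α′ * s) * z₃} {0ℤ * z₁ + + 1 * z₂ + - (β′ * s) * z₃}
        (linear-combination₁ y₁ s²≡1 (solve vs)) (linear-combination₁ (α′ * y₁) s²≡1 (solve vs))
        (linear-combination₁ (β′ * y₁) s²≡1 (solve vs))

apex-matrix-apex : ∀ α′ β′ {s} → s * s ≡ + 1 →
  apply (apex-matrix α′ β′ s) (+ 2 * α′ , + 2 * β′ , s * + 2) +₃ (+ 2 , 0ℤ , 0ℤ) ≡ (+ 0 , + 0 , + 0)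
apex-matrix-apex α′ β′ {s} s²≡1 =
  let vs = α′ ∷ β′ ∷ s ∷ [] in
  ≡₃ {x₁ = 0ℤ * (+ 2 * α′) + 0ℤ * (+ 2 * β′) + - s * (s * + 2) + + 2}
     {+ 1 * (+ 2 * α′) + 0ℤ * (+ 2 * β′) + - (α′ * s) * (s * + 2) + 0ℤ}
     {0ℤ * (+ 2 * α′) + + 1 * (+ 2 * β′) + - (β′ * s) * (s * + 2) + 0ℤ}
     (linear-combination₁ (- + 2) s²≡1 (solve vs)) (linear-combination₁ (- (+ 2 * α′)) s²≡1 (solve vs))
     (linear-combination₁ (- (+ 2 * β′)) s²≡1 (solve vs))

apex-matrix-base : ∀ α′ β′ s p₁ p₂ → apply (apex-matrix α′ β′ s) (p₁ , p₂ , 0ℤ) +₃ (+ 2 , 0ℤ , 0ℤ) ≡ (+ 2 , p₁ , p₂)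
apex-matrix-base α′ β′ s p₁ p₂ =
  let vs = α′ ∷ β′ ∷ s ∷ p₁ ∷ p₂ ∷ [] in
  ≡₃ {x₁ = 0ℤ * p₁ + 0ℤ * p₂ + - s * 0ℤ + + 2} {+ 1 * p₁ + 0ℤ * p₂ + - (α′ * s) * 0ℤ + 0ℤ}
     {0ℤ * p₁ + + 1 * p₂ + - (β′ * s) * 0ℤ + 0ℤ} (solve vs) (solve vs) (solve vs)

pyramid-equivalence : ∀ {O A B C : Pt3} P u v w α′ β′ {s} {p₁ p₂ p₃ : Pt2} → det3 u v w ≡ + 1 → s * s ≡ + 1 →
  O ≡ P +₃ apply (frame u v w) (+ 2 * α′ , + 2 * β′ , s * + 2) →
  (affMap2 P u v p₁ ∷ affMap2 P u v p₂ ∷ affMap2 P u v p₃ ∷ []) ↭ (A ∷ B ∷ C ∷ []) →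
  PyramidEquiv O A B C (+ 0 , + 0 , + 0) (+ 2 , p₁) (+ 2 , p₂) (+ 2 , p₃)
pyramid-equivalence {O} {A} {B} {C} P u v w α′ β′ {s} {p₁} {p₂} {p₃} det≡1 s²≡1 O≡ base =
  M , M⁻¹ , t , inverseˡ , inverseʳ , trans (cong F O≡) (trans (F-frame _) (apex-matrix-apex α′ β′ s²≡1)) ,
  ↭-sym (subst (_↭ (F A ∷ F B ∷ F C ∷ [])) images (map⁺ F base))
  where
  open ≡-Reasoning
  G G⁻¹ M M⁻¹ : Mat3
  G = apex-matrix α′ β′ s
  G⁻¹ = apex-matrix⁻¹ α′ β′ s
  M = G ⊙ coframe u v w
  M⁻¹ = frame u v w ⊙ G⁻¹
  t : Pt3
  t = (+ 2 , 0ℤ , 0ℤ) -₃ apply M P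
  F : Pt3 → Pt3
  F x = apply M x +₃ t
  unimodular : ∀ x → (det3 u v w) ·₃ x ≡ x
  unimodular x = trans (cong (_·₃ x) det≡1) (·₃-identityˡ x)
  inverseˡ : ∀ x → apply M⁻¹ (apply M x) ≡ x
  inverseˡ x = begin
    apply M⁻¹ (apply M x)                                         ≡⟨ apply-⊙ (frame u v w) G⁻¹ _ ⟩
    apply (frame u v w) (apply G⁻¹ (apply M x))                   ≡⟨ cong (λ y → apply (frame u v w) (apply G⁻¹ y)) (apply-⊙ G (coframe u v w) x) ⟩
    apply (frame u v w) (apply G⁻¹ (apply G (apply (coframe u v w) x))) ≡⟨ cong (apply (frame u v w)) (apex-matrix-inverseˡ α′ β′ s²≡1 _) ⟩
    apply (frame u v w) (apply (coframe u v w) x)                 ≡⟨ frame-coframe u v w x ⟩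
    det3 u v w ·₃ x                                               ≡⟨ unimodular x ⟩
    x                                                             ∎
  inverseʳ : ∀ y → apply M (apply M⁻¹ y) ≡ y
  inverseʳ y = begin
    apply M (apply M⁻¹ y)                                         ≡⟨ apply-⊙ G (coframe u v w) _ ⟩
    apply G (apply (coframe u v w) (apply M⁻¹ y))                 ≡⟨ cong (λ x → apply G (apply (coframe u v w) x)) (apply-⊙ (frame u v w) G⁻¹ y) ⟩
    apply G (apply (coframe u v w) (apply (frame u v w) (apply G⁻¹ y))) ≡⟨ cong (apply G) (coframe-frame u v w _) ⟩
    apply G (det3 u v w ·₃ apply G⁻¹ y)                           ≡⟨ cong (apply G) (unimodular _) ⟩
    apply G (apply G⁻¹ y)                                         ≡⟨ apex-matrix-inverseʳ α′ β′ s²≡1 y ⟩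
    y                                                             ∎
  F-frame : ∀ Y → F (P +₃ apply (frame u v w) Y) ≡ apply G Y +₃ (+ 2 , 0ℤ , 0ℤ)
  F-frame Y = begin
    F (P +₃ apply (frame u v w) Y)                                ≡⟨ apply-translate M P _ _ ⟩
    apply M (apply (frame u v w) Y) +₃ (+ 2 , 0ℤ , 0ℤ)            ≡⟨ cong (_+₃ (+ 2 , 0ℤ , 0ℤ)) (apply-⊙ G (coframe u v w) _) ⟩
    apply G (apply (coframe u v w) (apply (frame u v w) Y)) +₃ (+ 2 , 0ℤ , 0ℤ)
      ≡⟨ cong (λ Z → apply G Z +₃ (+ 2 , 0ℤ , 0ℤ)) (trans (coframe-frame u v w Y) (unimodular Y)) ⟩
    apply G Y +₃ (+ 2 , 0ℤ , 0ℤ)                                  ∎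
  image : ∀ p → F (affMap2 P u v p) ≡ (+ 2 , p)
  image (x , y) = trans (cong F (affMap2-frame P u v w x y)) (trans (F-frame _) (apex-matrix-base α′ β′ s x y))
  images : map F (affMap2 P u v p₁ ∷ affMap2 P u v p₂ ∷ affMap2 P u v p₃ ∷ []) ≡ (+ 2 , p₁) ∷ (+ 2 , p₂) ∷ (+ 2 , p₃) ∷ []
  images = cong₂ _∷_ (image p₁) (cong₂ _∷_ (image p₂) (cong₂ _∷_ (image p₃) refl))

module MarkedBase (P u v : Pt3) (a b c : Pt2) where

  ψ : Pt2 → Pt3
  ψ = affMap2 P u v

  A B C N : Pt3
  A = ψ a
  B = ψ b
  C = ψ c
  N = cross u v

  δ : ℤ
  δ = det₂ a b c

  height : Pt3 → ℤ
  height x = dot N (x -₃ P)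

  point : Pt3 → Pt3 → Pt3
  point w Y = P +₃ apply (frame u v w) Y

  OntoBaseLattice : Set
  OntoBaseLattice = ∀ Q → InPlane A B C (ι3 Q) → ∃[ p ] ψ p ≡ Q

  MinimalDistance : ℕ → Set
  MinimalDistance m = ∀ Q → δ * height Q ≢ 0ℤ → suc m ℕ.≤ ∣ δ * height Q ∣

  base-lattice-points : OntoBaseLattice → ∀ {w} → det3 u v w ≢ 0ℤ → δ ≢ 0ℤ → ∀ x → height x ≡ 0ℤ → ∃[ p ] ψ p ≡ x
  base-lattice-points lattice {w} g≢0 δ≢0 x height≡0 =
    lattice x (inPlane-intro {A} {B} {C} {x} (g * δ) {σ} {τ} gδ≢0 (plane-combination P u v w a b c x g ζ₁ ζ₂ coordinates))
    where
    g ζ₁ ζ₂ : ℤ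
    g = det3 u v w
    ζ₁ = dot (cross v w) (x -₃ P)
    ζ₂ = dot (cross w u) (x -₃ P)
    σ τ : ℤ
    σ = (ζ₁ - g * proj₁ a) * (proj₂ c - proj₂ a) - (ζ₂ - g * proj₂ a) * (proj₁ c - proj₁ a)
    τ = (ζ₂ - g * proj₂ a) * (proj₁ b - proj₁ a) - (ζ₁ - g * proj₁ a) * (proj₂ b - proj₂ a)
    coordinates : g ·₃ (x -₃ P) ≡ apply (frame u v w) (ζ₁ , ζ₂ , 0ℤ)
    coordinates = trans (sym (frame-coframe u v w (x -₃ P))) (cong (λ h → apply (frame u v w) (ζ₁ , ζ₂ , h)) height≡0)
    gδ≢0 : g * δ ≢ 0ℤ
    gδ≢0 gδ≡0 = [ g≢0 , δ≢0 ]′ (ℤP.i*j≡0⇒i≡0∨j≡0 g gδ≡0)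

  upward-vector : ∀ x → dot N x ≢ 0ℤ → ∃[ w ] ∃[ k ] (dot N w ≡ + suc k × ∣ dot N x ∣ ≡ suc k)
  upward-vector x Nx≢0 with dot N x in Nx≡
  ... | + 0      = ⊥-elim (Nx≢0 refl)
  ... | +[1+ k ] = x , k , Nx≡ , refl
  ... | -[1+ k ] = (- + 1) ·₃ x , k , trans (dot-·₃ʳ N (- + 1) x) (trans (cong (- + 1 *_) Nx≡) (ℤP.-1*i≡-i -[1+ k ])) , refl

  -- A nonzero remainder would give a lattice point closer to the base plane than the minimum.
  height-multiples : ∀ {m} → MinimalDistance m → ∀ {w k} → dot N w ≡ + suc k → ∣ δ ∣ ℕ.* suc k ≡ suc m →
    ∀ y → ∃[ q ] dot N y ≡ q * dot N w
  height-multiples {m} minimal {w} {k} Nw≡ δk≡m y =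
    q , trans (remainder-zero (dot N y %ℕ suc k) (n%ℕd<d (dot N y) (suc k)) (a≡a%ℕn+[a/ℕn]*n (dot N y) (suc k)))
              (cong (q *_) (sym Nw≡))
    where
    q : ℤ
    q = dot N y /ℕ suc k
    instance
      ∣δ∣-nonZero : ℕ.NonZero ∣ δ ∣
      ∣δ∣-nonZero = ℕP.m*n≢0⇒m≢0 ∣ δ ∣ {{subst ℕ.NonZero (sym δk≡m) _}}
    remainder-zero : ∀ r → r ℕ.< suc k → dot N y ≡ + r + q * + suc k → dot N y ≡ q * + suc k
    remainder-zero 0       _   e = trans e (ℤP.+-identityˡ _)
    remainder-zero (suc r) r<k e = ⊥-elim (ℕP.<⇒≱ closer (minimal Q δhQ≢0))
      where
      Q : Pt3
      Q = P +₃ (y -₃ (q ·₃ w))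
      cancel : ∀ x z g → x + z * g - z * g ≡ x
      cancel x z g = solve (x ∷ z ∷ g ∷ [])
      height-Q : height Q ≡ + suc r
      height-Q = trans (dot-shifted N P y q w) (trans (cong₂ (λ x g → x - q * g) e Nw≡) (cancel (+ suc r) q (+ suc k)))
      ∣δhQ∣≡ : ∣ δ * height Q ∣ ≡ ∣ δ ∣ ℕ.* suc r
      ∣δhQ∣≡ = trans (ℤP.abs-* δ (height Q)) (cong (λ h → ∣ δ ∣ ℕ.* ∣ h ∣) height-Q)
      closer : ∣ δ * height Q ∣ ℕ.< suc m
      closer = subst₂ ℕ._<_ (sym ∣δhQ∣≡) δk≡m (ℕP.*-monoʳ-< ∣ δ ∣ r<k)
      δhQ≢0 : δ * height Q ≢ 0ℤ
      δhQ≢0 δhQ≡0 = ℕ.≢-nonZero⁻¹ (∣ δ ∣ ℕ.* suc r) {{ℕP.m*n≢0 ∣ δ ∣ (suc r)}} (trans (sym ∣δhQ∣≡) (cong ∣_∣ δhQ≡0))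

  frame-spans : OntoBaseLattice → δ ≢ 0ℤ → ∀ {w} → det3 u v w ≢ 0ℤ → (∀ y → ∃[ q ] dot N y ≡ q * dot N w) →
    ∀ y → ∃[ Y ] y ≡ apply (frame u v w) Y
  frame-spans lattice δ≢0 {w} g≢0 multiple y =
    (proj₁ p , proj₂ p , q) , frame-decomposition P u v w y (proj₁ p) (proj₂ p) q (proj₂ found)
    where
    q : ℤ
    q = proj₁ (multiple y)
    in-base-plane : height (P +₃ (y -₃ (q ·₃ w))) ≡ 0ℤ
    in-base-plane = trans (dot-shifted N P y q w)
      (trans (cong (_- q * dot N w) (proj₂ (multiple y))) (ℤP.+-inverseʳ (q * dot N w)))
    found : ∃[ p ] ψ p ≡ P +₃ (y -₃ (q ·₃ w))
    found = base-lattice-points lattice g≢0 δ≢0 _ in-base-plane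
    p : Pt2
    p = proj₁ found

  unimodular-completion : OntoBaseLattice → ∀ {m} → MinimalDistance m → (∃[ P₀ ] ∣ δ * height P₀ ∣ ≡ suc m) →
    ∃[ w ] (det3 u v w ≡ + 1 × ∣ δ ∣ ≡ suc m)
  unimodular-completion lattice {m} minimal (P₀ , ∣δh∣≡) = complete (upward-vector (P₀ -₃ P) h≢0)
    where
    δ≢0 : δ ≢ 0ℤ
    δ≢0 δ≡0 = ℕP.0≢1+n (trans (cong (λ d → ∣ d * height P₀ ∣) (sym δ≡0)) ∣δh∣≡)
    h≢0 : height P₀ ≢ 0ℤ
    h≢0 h≡0 = ℕP.0≢1+n (trans (cong ∣_∣ (sym (trans (cong (δ *_) h≡0) (ℤP.*-zeroʳ δ)))) ∣δh∣≡)
    complete : ∃[ w ] ∃[ k ] (dot N w ≡ + suc k × ∣ height P₀ ∣ ≡ suc k) → ∃[ w ] (det3 u v w ≡ + 1 × ∣ δ ∣ ≡ suc m)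
    complete (w , k , Nw≡ , ∣h∣≡) = w , det≡1 , trans (sym (ℕP.*-identityʳ ∣ δ ∣)) (subst (λ k → ∣ δ ∣ ℕ.* suc k ≡ suc m) k≡0 δk≡m)
      where
      det≡ : det3 u v w ≡ + suc k
      det≡ = trans (det3-cross u v w) Nw≡
      δk≡m : ∣ δ ∣ ℕ.* suc k ≡ suc m
      δk≡m = trans (cong (∣ δ ∣ ℕ.*_) (sym ∣h∣≡)) (trans (sym (ℤP.abs-* δ (height P₀))) ∣δh∣≡)
      k≡0 : k ≡ 0
      k≡0 = spanning-frame-unimodular u v w det≡ (frame-spans lattice δ≢0 (λ det≡0 → +[1+]≢0 (trans (sym det≡) det≡0)) (height-multiples minimal Nw≡ δk≡m))
        where
        +[1+]≢0 : + suc k ≢ 0ℤ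
        +[1+]≢0 ()
      det≡1 : det3 u v w ≡ + 1
      det≡1 = trans det≡ (cong (λ k → + suc k) k≡0)

  apex-height : ∀ {O m l} → ∣ δ ∣ ≡ suc m → ∣ δ * height O ∣ ≡ l ℕ.* suc m → ∣ height O ∣ ≡ l
  apex-height {O} {m} {l} ∣δ∣≡ e = ℕP.*-cancelˡ-≡ ∣ height O ∣ l (suc m) (begin
    suc m ℕ.* ∣ height O ∣    ≡⟨ cong (ℕ._* ∣ height O ∣) ∣δ∣≡ ⟨
    ∣ δ ∣ ℕ.* ∣ height O ∣    ≡⟨ ℤP.abs-* δ (height O) ⟨
    ∣ δ * height O ∣          ≡⟨ e ⟩
    l ℕ.* suc m               ≡⟨ ℕP.*-comm l (suc m) ⟩
    suc m ℕ.* l               ∎)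
    where open ≡-Reasoning

  dot-point : ∀ {w} → det3 u v w ≡ + 1 → ∀ Y → dot N (point w Y) ≡ dot N P + proj₂ (proj₂ Y)
  dot-point {w} det≡1 Y =
    trans (dot-frame P u v w Y) (cong (λ z → dot N P + z) (trans (cong (_* proj₂ (proj₂ Y)) det≡1) (ℤP.*-identityˡ _)))

  slice-point-in-pyramid : ∀ {w D l α β s O} .{{_ : ℕ.NonZero D}} .{{_ : ℕ.NonZero l}} →
    O ≡ point w (α , β , s * + l) → (sp : SlicePoint D l α β a b c) →
    InPyramid O A B C (point w (SlicePoint.q₁ sp , SlicePoint.q₂ sp , s))
  slice-point-in-pyramid {w} {D} {l} {α} {β} {s} refl sp =
    inPyramid-intro {point w (α , β , s * + l)} {A} {B} {C} {point w (q₁ , q₂ , s)} (D ℕ.* l) {{ℕP.m*n≢0 D l}} n₁-nonNeg n₂-nonNeg n₃-nonNeg weights≤ scaled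
    where
    open SlicePoint sp
    weights≤ : n₁ + n₂ + n₃ ℤ.≤ + (D ℕ.* l)
    weights≤ = subst (n₁ + n₂ + n₃ ℤ.≤_) (trans total (sym (ℤP.pos-* D l))) (ℤP.i≤i+j (n₁ + n₂ + n₃) (+ D))
    scaled : (+ (D ℕ.* l)) ·₃ point w (q₁ , q₂ , s) ≡ ((+ (D ℕ.* l)) ·₃ point w (α , β , s * + l)) +₃
               ((n₁ ·₃ (A -₃ point w (α , β , s * + l))) +₃ ((n₂ ·₃ (B -₃ point w (α , β , s * + l))) +₃
                (n₃ ·₃ (C -₃ point w (α , β , s * + l)))))
    scaled = subst (λ k → k ·₃ point w (q₁ , q₂ , s) ≡ (k ·₃ point w (α , β , s * + l)) +₃
                            ((n₁ ·₃ (A -₃ point w (α , β , s * + l))) +₃ ((n₂ ·₃ (B -₃ point w (α , β , s * + l))) +₃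
                             (n₃ ·₃ (C -₃ point w (α , β , s * + l))))))
               (sym (ℤP.pos-* D l))
               (pyramid-combination P u v w a b c (+ D) (+ l) q₁ q₂ s α β n₁ n₂ n₃ total first second)

  slice-point-excluded : ∀ {w D L′ α β s O} .{{_ : ℕ.NonZero D}} → det3 u v w ≡ + 1 → s * s ≡ + 1 →
    O ≡ point w (α , β , s * + (2 ℕ.+ L′)) → CompletelyEmpty O A B C → ¬ SlicePoint D (2 ℕ.+ L′) α β a b c
  slice-point-excluded {w} {D} {L′} {α} {β} {s} {O} det≡1 s²≡1 O≡ empty sp =
    [ apex-mismatch , off-base ]′ (empty X (slice-point-in-pyramid {w} O≡ sp))
    where
    open SlicePoint sp
    X : Pt3
    X = point w (q₁ , q₂ , s)
    s≢0 : s ≢ 0ℤ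
    s≢0 s≡0 = 0≢1 (trans (cong (λ x → x * x) (sym s≡0)) s²≡1)
      where
      0≢1 : 0ℤ * 0ℤ ≢ + 1
      0≢1 ()
    apex-mismatch : X ≡ O → ⊥
    apex-mismatch X≡O = 1≢l (ℤP.*-cancelˡ-≡ s (+ 1) (+ (2 ℕ.+ L′)) {{ℤ.≢-nonZero s≢0}} (trans (ℤP.*-identityʳ s) s≡sl))
      where
      s≡sl : s ≡ s * + (2 ℕ.+ L′)
      s≡sl = +-cancelˡ (dot N P) (begin
        dot N P + s                        ≡⟨ dot-point det≡1 (q₁ , q₂ , s) ⟨
        dot N X                            ≡⟨ cong (dot N) (trans X≡O O≡) ⟩
        dot N (point w (α , β , s * + (2 ℕ.+ L′))) ≡⟨ dot-point det≡1 (α , β , s * + (2 ℕ.+ L′)) ⟩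
        dot N P + s * + (2 ℕ.+ L′)         ∎)
        where open ≡-Reasoning
      1≢l : + 1 ≢ + (2 ℕ.+ L′)
      1≢l ()
    off-base : ¬ InTriangle A B C X
    off-base X∈ABC = s≢0 (+-cancelˡ (dot N P) (begin
      dot N P + s     ≡⟨ dot-point det≡1 (q₁ , q₂ , s) ⟨
      dot N X         ≡⟨ inTriangle-level N X∈ABC (dot-affMap2 P u v a) (dot-affMap2 P u v b) (dot-affMap2 P u v c) ⟩
      dot N P         ≡⟨ ℤP.+-identityʳ (dot N P) ⟨
      dot N P + 0ℤ    ∎))
      where open ≡-Reasoning

  StandardApex : Pt3 → Set
  StandardApex O = ∃[ w ] ∃[ α′ ] ∃[ β′ ] ∃[ s ]
    (det3 u v w ≡ + 1 × s * s ≡ + 1 × O ≡ point w (+ 2 * α′ , + 2 * β′ , s * + 2))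

  apex-position : ∀ {D} .{{_ : ℕ.NonZero D}} {O l} → OntoBaseLattice → CompletelyEmpty O A B C →
    (∀ L′ α β → Exceptional (2 ℕ.+ L′) α β ⊎ SlicePoint D (2 ℕ.+ L′) α β a b c) →
    IntDist O A B C l → 1 < l → l ≡ 2 × StandardApex O
  apex-position {D} {O} {suc (suc L′)} lattice empty slices (m , (P₀ , ∣P₀∣) , minimal , ∣O∣) _ =
    locate (unimodular-completion lattice minimal′ (P₀ , distance P₀ ∣P₀∣))
    where
    distance : ∀ Q {k} → ∣ dot (cross (B -₃ A) (C -₃ A)) (Q -₃ A) ∣ ≡ k → ∣ δ * height Q ∣ ≡ k
    distance Q = trans (cong ∣_∣ (sym (base-normal P u v a b c Q)))
    minimal′ : MinimalDistance m
    minimal′ Q δh≢0 = subst (λ z → suc m ℕ.≤ ∣ z ∣) (base-normal P u v a b c Q)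
      (minimal Q (λ e → δh≢0 (trans (sym (base-normal P u v a b c Q)) e)))
    locate : ∃[ w ] (det3 u v w ≡ + 1 × ∣ δ ∣ ≡ suc m) → suc (suc L′) ≡ 2 × StandardApex O
    locate (w , det≡1 , ∣δ∣≡) = place (unit-multiple (height O) (apex-height {O} ∣δ∣≡ (distance O ∣O∣)))
      where
      α β : ℤ
      α = dot (cross v w) (O -₃ P)
      β = dot (cross w u) (O -₃ P)
      place : ∃[ s ] (s * s ≡ + 1 × height O ≡ s * + (2 ℕ.+ L′)) → suc (suc L′) ≡ 2 × StandardApex O
      place (s , s²≡1 , h≡) = decide (slices L′ α β)
        where
        O≡ : ∀ {x y z} → α ≡ x → β ≡ y → s * + (2 ℕ.+ L′) ≡ z → O ≡ point w (x , y , z)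
        O≡ α≡ β≡ z≡ = trans (frame-coframe-point P u v w O det≡1) (cong (point w) (≡₃ α≡ β≡ (trans h≡ z≡)))
        decide : Exceptional (2 ℕ.+ L′) α β ⊎ SlicePoint D (2 ℕ.+ L′) α β a b c → suc (suc L′) ≡ 2 × StandardApex O
        decide (inj₂ sp) = ⊥-elim (slice-point-excluded {w} {D} {L′} {α} {β} {s} {O} det≡1 s²≡1 (O≡ refl refl refl) empty sp)
        decide (inj₁ (l≡2 , α′ , β′ , α≡ , β≡)) =
          l≡2 , w , α′ , β′ , s , det≡1 , s²≡1 , O≡ α≡ β≡ (cong (λ l → s * + l) l≡2)
  apex-position {l = 0}     _ _ _ _ ()
  apex-position {l = suc 0} _ _ _ _ (ℕ.s≤s ())

mainTheorem12 :
    ∀ (O A B C : Pt3) →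
    NonDegenerate O A B C →
    CompletelyEmpty O A B C →
    (∃[ l ] (IntDist O A B C l × 1 < l)) →
    TriangleEquiv A B C (-[1+ 1 ] , + 1) (-[1+ 0 ] , -[1+ 0 ]) (+ 1 , + 2) →
    IntDist O A B C 2 ×
    PyramidEquiv O A B C (+ 0 , + 0 , + 0)
      (+ 2 , -[1+ 1 ] , + 1) (+ 2 , -[1+ 0 ] , -[1+ 0 ]) (+ 2 , + 1 , + 2)
mainTheorem12 O A B C _ empty (l , distance , 1<l) (P , u , v , _ , _ , lattice , base)
  with arrangement-preimage (affMap2 P u v) (↭-arrangement base)
... | a , b , c , arrangement , refl , refl , refl =
  let open MarkedBase P u v a b c using (apex-position)
      (l≡2 , w , α′ , β′ , s , det≡1 , s²≡1 , O≡) =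
        apex-position lattice empty (λ L′ α β → map₂ (SlicePoint-arrange arrangement) (slice-dichotomy L′ α β)) distance 1<l
  in subst (IntDist O A B C) l≡2 distance , pyramid-equivalence {O} P u v w α′ β′ {s} {T₁} {T₂} {T₃} det≡1 s²≡1 O≡ base
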